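{- For integers $n\ge m\ge 8$, (i) $t^{0}(C_n\square C_m)=4$, $t^{1}(C_n\square C_m)=7$, $t^{2}(C_n\square C_m)=11$; and (ii) $t^{3}(C_n\square C_m)\le 4m-1$.
   Context: $C_n$ is the cycle on $n$ vertices and $\square$ the Cartesian product. For a graph $\Gamma=(V,E)$ and $F\subseteq V$, $F$ is a $g$-good-neighbor conditional faulty set if every vertex of $V\setminus F$ has at least $g$ neighbors in $V\setminus F$. PMC model: distinct $F_1,F_2\subseteq V$ are distinguishable iff there exist $u\in F_1\triangle F_2$, $v\in V\setminus(F_1\cup F_2)$ with $uv\in E$. $t^g(\Gamma)$ is the maximum $t$ such that every pair of distinct $g$-good-neighbor conditional faulty sets of size at most $t$ is distinguishable. -}

module Defs where

open import Data.Nat using (ℕ; zero; suc; _≤_; _≥_; _*_)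
open import Data.Fin using (Fin; toℕ; remQuot)
open import Data.Fin.Subset using (Subset; _∈_; _∉_; ∣_∣)
open import Data.Product using (Σ; _×_; _,_; proj₁; proj₂)
open import Data.Sum using (_⊎_)
open import Relation.Binary.PropositionalEquality using (_≡_; _≢_)

CycleAdj : (n : ℕ) → Fin n → Fin n → Set
CycleAdj n i j = Succ i j ⊎ Succ j i
  where
  Succ : Fin n → Fin n → Set
  Succ a b = (toℕ b ≡ suc (toℕ a)) ⊎ ((suc (toℕ a) ≡ n) × (toℕ b ≡ 0))

TorusAdj' : (n m : ℕ) → Fin n × Fin m → Fin n × Fin m → Set
TorusAdj' n m (a , b) (c , d) =
  ((a ≡ c) × CycleAdj m b d) ⊎ ((b ≡ d) × CycleAdj n a c)

TorusAdj : (n m : ℕ) → Fin (n * m) → Fin (n * m) → Set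
TorusAdj n m x y = TorusAdj' n m (remQuot {n} m x) (remQuot {n} m y)

module _ {N : ℕ} (Adj : Fin N → Fin N → Set) where

  GoodNeighbor : ℕ → Subset N → Set
  GoodNeighbor g F = ∀ v → v ∉ F →
    Σ (Subset N) λ S → (g ≤ ∣ S ∣) × (∀ u → u ∈ S → Adj v u × u ∉ F)

  Distinguishable : Subset N → Subset N → Set
  Distinguishable F₁ F₂ = Σ (Fin N) λ u → Σ (Fin N) λ v →
    (((u ∈ F₁) × (u ∉ F₂)) ⊎ ((u ∈ F₂) × (u ∉ F₁))) ×
    (v ∉ F₁) × (v ∉ F₂) × Adj u v

  Diagnosable : ℕ → ℕ → Set
  Diagnosable g t = ∀ F₁ F₂ → GoodNeighbor g F₁ → GoodNeighbor g F₂ →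
    ∣ F₁ ∣ ≤ t → ∣ F₂ ∣ ≤ t → F₁ ≢ F₂ → Distinguishable F₁ F₂

  IsDiagnosability : ℕ → ℕ → Set
  IsDiagnosability g t = Diagnosable g t × (∀ t' → Diagnosable g t' → t' ≤ t)

module Submission where

-- Let F₁ ≠ F₂ be g-good faulty sets of size at most t that no PMC test tells apart, and call the
-- vertices of F₁ ∩ F₂ agreed and those of F₁ △ F₂ disputed; all neighbours of a disputed vertex
-- lie in F₁ ∪ F₂. Walking along the row of a disputed vertex one stays in F₁ ∪ F₂ until an agreed
-- vertex is met, so the row contains two agreed vertices or lies inside F₁ ∪ F₂. If t ≤ 11 and at
-- most seven vertices are agreed, a row inside F₁ ∪ F₂ with fewer than two agreed vertices has at
-- least seven disputed vertices, and each of their columns contains two agreed vertices or lies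
-- inside F₁ ∪ F₂, which overflows |F₁ ∩ F₂| ≤ 7 or |F₁ ∪ F₂| ≤ 22. So every disputed vertex sees
-- two agreed vertices in its row and two in its column. A vertex of F₁ ∖ F₂ has g neighbours in
-- F₁ ∖ F₂ because F₂ is g-good, and these vertices together with the agreed vertices on their rows
-- and columns give |F₁| > 4, 7, 11 for g = 0, 1, 2. Conversely, when A is a 1×1, 1×2 or 2×2 block
-- or a band of two rows, N(A) and N(A) ∪ A are g-good faulty sets that no test tells apart, of
-- sizes at most 5, 8, 12 and 4m.

open import Data.Nat using (ℕ; _≤_; _*_; _∸_)
open import Data.Product using (_×_)

open import Data.Bool.Base using (Bool; true; false; T; _∧_; _∨_; _xor_; not)
open import Data.Bool.Properties using (T?; T-≡; T-∨)
open import Data.Empty using (⊥)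
open import Data.Fin.Base using (Fin; toℕ; combine; remQuot)
open import Data.Fin.Properties using (toℕ-fromℕ<; toℕ-injective; toℕ<n; any?; remQuot-combine; combine-remQuot)
  renaming (_≟_ to _≟ᶠ_)
open import Data.Fin.Subset using (Subset; _∈_; _∉_; _⊆_; ∣_∣; _-_; _∪_; ⁅_⁆; inside; outside)
  renaming (⊥ to ∅)
open import Data.Fin.Subset.Properties
  using (_∈?_; ⊆-antisym; p⊆q⇒∣p∣≤∣q∣; x∈p⇒∣p-x∣<∣p∣; x∈p∧x∉q⇒x∈p─q; x≢y⇒x∉⁅y⁆; x∈p∪q⁺; x∈p∪q⁻;
         x∈⁅x⁆; x∈⁅y⁆⇒x≡y; ∣p∣≤∣x∷p∣; ∣⊥∣≡0; ∣⁅x⁆∣≡1; ∉⊥)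
open import Data.List.Base
  using (List; []; _∷_; _++_; length; map; filter; foldr; applyUpTo; upTo; allFin; cartesianProduct)
open import Data.List.Properties using (length-map; length-++; length-applyUpTo; length-tabulate)
open import Data.List.Membership.Propositional using () renaming (_∈_ to _∈ₗ_; _∉_ to _∉ₗ_)
open import Data.List.Membership.Propositional.Properties
  using (∈-map⁺; ∈-map⁻; ∈-filter⁺; ∈-cartesianProduct⁺; ∈-upTo⁺; ∈-allFin)
open import Data.List.Relation.Unary.All as All using (All; []; _∷_)
import Data.List.Relation.Unary.All.Properties as All
open import Data.List.Relation.Unary.AllPairs using ([]; _∷_)
open import Data.List.Relation.Unary.Any using (here; there)
open import Data.List.Relation.Unary.Unique.Propositional using (Unique)
import Data.List.Relation.Unary.Unique.Propositional.Properties as Unique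
open import Data.Nat.Base using (zero; suc; _+_; _<_; z≤n; s≤s; z<s; pred; NonZero; >-nonZero)
open import Data.Nat.DivMod
  using (_%_; _/_; _mod_; m≡m%n+[m/n]*n; [m+kn]%n≡m%n; [m+n]%n≡m%n; m%n<n; m<n⇒m%n≡m; n%n≡0; m≤n⇒[n∸m]%m≡n%m)
open import Data.Nat.Properties
open import Algebra.Properties.CommutativeSemigroup +-commutativeSemigroup using (x∙yz≈y∙xz)
open import Data.Product.Base using (Σ-syntax; ∃; _,_; proj₁; proj₂; swap)
open import Data.Product.Properties using (≡-dec)
open import Data.Sum.Base using (_⊎_; inj₁; inj₂; [_,_]′)
import Data.Sum.Base as Sum
open import Data.Vec.Base using ([]; _∷_; lookup; tabulate)
open import Data.Vec.Properties using ([]=⇒lookup; lookup⇒[]=; lookup∘tabulate)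
open import Function.Base using (_∘_; id)
open import Function.Bundles using (Equivalence)
open import Relation.Binary.Definitions using (DecidableEquality; tri<; tri≈; tri>)
open import Relation.Binary.PropositionalEquality
open import Relation.Nullary using (¬_; Dec; does; yes; no; contradiction)
open import Relation.Nullary.Decidable
  using (_×-dec_; _⊎-dec_; ¬?; isYes; toWitness; fromWitness; decidable-stable)
open import Relation.Unary using (Decidable)
open import Defs

-- Cycles and the torus

-- Defs unfolds CycleAdj m a b to Succ m a b ⊎ Succ m b a definitionally.
Succℕ : ℕ → ℕ → ℕ → Set
Succℕ m i j = j ≡ suc i ⊎ (suc i ≡ m × j ≡ 0)

Succ : (m : ℕ) → Fin m → Fin m → Set
Succ m a b = Succℕ m (toℕ a) (toℕ b)

Succℕ-functional : ∀ {m i j k} → j < m → k < m → Succℕ m i j → Succℕ m i k → j ≡ k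
Succℕ-functional _   _   (inj₁ refl)       (inj₁ refl)       = refl
Succℕ-functional j<m _   (inj₁ refl)       (inj₂ (refl , _)) = contradiction j<m (<-irrefl refl)
Succℕ-functional _   k<m (inj₂ (refl , _)) (inj₁ refl)       = contradiction k<m (<-irrefl refl)
Succℕ-functional _   _   (inj₂ (_ , refl)) (inj₂ (_ , refl)) = refl

Succℕ-injective : ∀ {m i j k} → Succℕ m i k → Succℕ m j k → i ≡ j
Succℕ-injective (inj₁ refl)       (inj₁ k≡1+j)       = suc-injective k≡1+j
Succℕ-injective (inj₁ refl)       (inj₂ (_ , ()))
Succℕ-injective (inj₂ (_ , refl)) (inj₁ ())
Succℕ-injective (inj₂ (1+i≡m , _)) (inj₂ (1+j≡m , _)) = suc-injective (trans 1+i≡m (sym 1+j≡m))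

Succℕ-irrefl : ∀ {m i} → 2 ≤ m → ¬ Succℕ m i i
Succℕ-irrefl _   (inj₁ i≡1+i)         = 1+n≢n (sym i≡1+i)
Succℕ-irrefl 2≤m (inj₂ (refl , refl)) = 1+n≰n 2≤m

Succℕ-asym : ∀ {m i j} → 3 ≤ m → Succℕ m i j → ¬ Succℕ m j i
Succℕ-asym _   (inj₁ refl)          (inj₁ i≡2+i)         = m≢1+n+m _ i≡2+i
Succℕ-asym 3≤m (inj₁ refl)          (inj₂ (refl , refl)) = 1+n≰n 3≤m
Succℕ-asym 3≤m (inj₂ (refl , refl)) (inj₁ refl)          = contradiction 3≤m λ { (s≤s (s≤s ())) }
Succℕ-asym 3≤m (inj₂ (refl , refl)) (inj₂ (refl , _))    = contradiction 3≤m λ { (s≤s ()) }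

Succℕ-no-3-cycle : ∀ {m i j k} → 4 ≤ m → Succℕ m i j → Succℕ m j k → ¬ Succℕ m k i
Succℕ-no-3-cycle _   (inj₁ refl)          (inj₁ refl)          (inj₁ i≡3+i)         = m≢1+n+m _ i≡3+i
Succℕ-no-3-cycle 4≤m (inj₁ refl)          (inj₁ refl)          (inj₂ (refl , refl)) = 1+n≰n 4≤m
Succℕ-no-3-cycle 4≤m (inj₁ refl)          (inj₂ (refl , refl)) (inj₁ refl)          = 1+n≰n 4≤m
Succℕ-no-3-cycle _   (inj₁ refl)          (inj₂ (refl , refl)) (inj₂ (() , _))
Succℕ-no-3-cycle 4≤m (inj₂ (refl , refl)) (inj₁ refl)          (inj₁ refl)          = 1+n≰n 4≤m
Succℕ-no-3-cycle _   (inj₂ (refl , refl)) (inj₁ refl)          (inj₂ (refl , ()))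
Succℕ-no-3-cycle 4≤m (inj₂ (refl , refl)) (inj₂ (refl , refl)) _                    = contradiction 4≤m λ { (s≤s ()) }

Succℕ-inner : ∀ {m i j} → Succℕ m i j → suc i < m → j ≡ suc i
Succℕ-inner (inj₁ j≡1+i)       _     = j≡1+i
Succℕ-inner (inj₂ (1+i≡m , _)) 1+i<m = contradiction 1+i≡m (<⇒≢ 1+i<m)

Succℕ-pred : ∀ {m i j k} → Succℕ m i j → j ≡ suc k → i ≡ k
Succℕ-pred (inj₁ refl)       j≡1+k = suc-injective j≡1+k
Succℕ-pred (inj₂ (_ , refl)) ()

Succℕ-wrap : ∀ {m i j} → Succℕ m i j → j ≡ 0 → suc i ≡ m
Succℕ-wrap (inj₁ refl)        ()
Succℕ-wrap (inj₂ (1+i≡m , _)) _ = 1+i≡m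

Succ-functional : ∀ {m} {a b c : Fin m} → Succ m a b → Succ m a c → b ≡ c
Succ-functional {b = b} {c} ab ac = toℕ-injective (Succℕ-functional (toℕ<n b) (toℕ<n c) ab ac)

Succ-injective : ∀ {m} {a b c : Fin m} → Succ m a c → Succ m b c → a ≡ b
Succ-injective ac bc = toℕ-injective (Succℕ-injective ac bc)

CycleAdj-irrefl : ∀ {m} {a : Fin m} → 2 ≤ m → ¬ CycleAdj m a a
CycleAdj-irrefl 2≤m (inj₁ aa) = Succℕ-irrefl 2≤m aa
CycleAdj-irrefl 2≤m (inj₂ aa) = Succℕ-irrefl 2≤m aa

CycleAdj⇒≢ : ∀ {m} {a b : Fin m} → 2 ≤ m → CycleAdj m a b → a ≢ b
CycleAdj⇒≢ 2≤m adj refl = CycleAdj-irrefl 2≤m adj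

-- Orienting the three edges along Succ either repeats a vertex or closes a 3-cycle.
CycleAdj-triangle-free : ∀ {m} {a b c : Fin m} → 4 ≤ m →
                         CycleAdj m a b → CycleAdj m a c → b ≢ c → ¬ CycleAdj m b c
CycleAdj-triangle-free _   (inj₁ ab) (inj₁ ac) b≢c _ = b≢c (Succ-functional ab ac)
CycleAdj-triangle-free _   (inj₂ ba) (inj₂ ca) b≢c _ = b≢c (Succ-injective ba ca)
CycleAdj-triangle-free 4≤m (inj₁ ab) (inj₂ ca) _ (inj₁ bc) = Succℕ-no-3-cycle 4≤m ab bc ca
CycleAdj-triangle-free 4≤m (inj₁ ab) (inj₂ ca) _ (inj₂ cb)
  with refl ← Succ-functional ca cb = Succℕ-irrefl (≤-trans (m≤m+n 2 2) 4≤m) ab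
CycleAdj-triangle-free 4≤m (inj₂ ba) (inj₁ ac) _ (inj₁ bc)
  with refl ← Succ-functional ba bc = Succℕ-irrefl (≤-trans (m≤m+n 2 2) 4≤m) ac
CycleAdj-triangle-free 4≤m (inj₂ ba) (inj₁ ac) _ (inj₂ cb) = Succℕ-no-3-cycle 4≤m ba ac cb

CycleAdj? : ∀ {m} (a b : Fin m) → Dec (CycleAdj m a b)
CycleAdj? {m} a b = succ? a b ⊎-dec succ? b a
  where
    succ? : ∀ (a b : Fin m) → Dec (Succ m a b)
    succ? a b = (toℕ b ≟ suc (toℕ a)) ⊎-dec ((suc (toℕ a) ≟ m) ×-dec (toℕ b ≟ 0))

CycleAdj-sym : ∀ {m} {a b : Fin m} → CycleAdj m a b → CycleAdj m b a
CycleAdj-sym = Sum.swap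

rotate : ∀ {m} → ℕ → Fin m → Fin m
rotate {suc m} k b = (k + toℕ b) mod suc m

toℕ-rotate : ∀ {m} k (b : Fin (suc m)) → toℕ (rotate k b) ≡ (k + toℕ b) % suc m
toℕ-rotate k b = toℕ-fromℕ< _

[d+x%m]%m≡[d+x]%m : ∀ d x m .{{_ : NonZero m}} → (d + x % m) % m ≡ (d + x) % m
[d+x%m]%m≡[d+x]%m d x m = sym (begin
  (d + x) % m                      ≡⟨ cong (λ y → (d + y) % m) (m≡m%n+[m/n]*n x m) ⟩
  (d + (x % m + (x / m) * m)) % m  ≡⟨ cong (_% m) (sym (+-assoc d (x % m) _)) ⟩
  (d + x % m + (x / m) * m) % m    ≡⟨ [m+kn]%n≡m%n (d + x % m) (x / m) m ⟩
  (d + x % m) % m                  ∎)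
  where open ≡-Reasoning

Succℕ-% : ∀ m x .{{_ : NonZero m}} → Succℕ m (x % m) (suc x % m)
Succℕ-% m x with m≤n⇒m<n∨m≡n (m%n<n x m)
... | inj₁ 1+r<m = inj₁ (trans (sym ([d+x%m]%m≡[d+x]%m 1 x m)) (m<n⇒m%n≡m 1+r<m))
... | inj₂ 1+r≡m =
  inj₂ (1+r≡m , trans (sym ([d+x%m]%m≡[d+x]%m 1 x m)) (trans (cong (_% m) 1+r≡m) (n%n≡0 m)))

Succ-rotate : ∀ {m} k (b : Fin m) → Succ m (rotate k b) (rotate (suc k) b)
Succ-rotate {suc m} k b rewrite toℕ-rotate k b | toℕ-rotate (suc k) b = Succℕ-% (suc m) (k + toℕ b)

rotate-zero : ∀ {m} (b : Fin m) → rotate 0 b ≡ b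
rotate-zero {suc m} b = toℕ-injective (trans (toℕ-rotate 0 b) (m<n⇒m%n≡m (toℕ<n b)))

rotate-period : ∀ {m} (b : Fin m) → rotate m b ≡ b
rotate-period {suc m} b = toℕ-injective (begin
  toℕ (rotate (suc m) b)   ≡⟨ toℕ-rotate (suc m) b ⟩
  (suc m + toℕ b) % suc m  ≡⟨ cong (_% suc m) (+-comm (suc m) (toℕ b)) ⟩
  (toℕ b + suc m) % suc m  ≡⟨ [m+n]%n≡m%n (toℕ b) (suc m) ⟩
  toℕ b % suc m            ≡⟨ m<n⇒m%n≡m (toℕ<n b) ⟩
  toℕ b                    ∎)
  where open ≡-Reasoning

[d+r]%m≢r : ∀ {m d r} .{{_ : NonZero m}} → 0 < d → d < m → r < m → (d + r) % m ≢ r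
[d+r]%m≢r {m} {d} {r} 0<d d<m r<m eq with d + r <? m
... | yes d+r<m = <⇒≢ (m<n+m r 0<d) (trans (sym eq) (m<n⇒m%n≡m d+r<m))
... | no d+r≮m = <⇒≢ d<m (+-cancelʳ-≡ r d m (begin
  d + r          ≡⟨ m∸n+n≡m m≤d+r ⟨
  d + r ∸ m + m  ≡⟨ cong (_+ m) wrapped ⟩
  r + m          ≡⟨ +-comm r m ⟩
  m + r          ∎))
  where
    open ≡-Reasoning
    m≤d+r : m ≤ d + r
    m≤d+r = ≮⇒≥ d+r≮m
    d+r∸m<m : d + r ∸ m < m
    d+r∸m<m = subst (d + r ∸ m <_) (m+n∸n≡m m m) (∸-monoˡ-< (+-mono-< d<m r<m) m≤d+r)
    wrapped : d + r ∸ m ≡ r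
    wrapped = begin
      d + r ∸ m        ≡⟨ m<n⇒m%n≡m d+r∸m<m ⟨
      (d + r ∸ m) % m  ≡⟨ m≤n⇒[n∸m]%m≡n%m m≤d+r ⟩
      (d + r) % m      ≡⟨ eq ⟩
      r                ∎

rotate-≢ : ∀ {m i j} (b : Fin m) → i < j → j < m → rotate i b ≢ rotate j b
rotate-≢ {suc m} {i} {j} b i<j j<m eq =
  [d+r]%m≢r (m<n⇒0<n∸m i<j) (≤-<-trans (m∸n≤m j i) j<m) (m%n<n (i + toℕ b) (suc m)) (begin
    (j ∸ i + (i + toℕ b) % suc m) % suc m  ≡⟨ [d+x%m]%m≡[d+x]%m (j ∸ i) (i + toℕ b) (suc m) ⟩
    (j ∸ i + (i + toℕ b)) % suc m          ≡⟨ cong (_% suc m) (sym (+-assoc (j ∸ i) i (toℕ b))) ⟩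
    (j ∸ i + i + toℕ b) % suc m            ≡⟨ cong (λ k → (k + toℕ b) % suc m) (m∸n+n≡m (<⇒≤ i<j)) ⟩
    (j + toℕ b) % suc m                    ≡⟨ toℕ-rotate j b ⟨
    toℕ (rotate j b)                       ≡⟨ cong toℕ eq ⟨
    toℕ (rotate i b)                       ≡⟨ toℕ-rotate i b ⟩
    (i + toℕ b) % suc m                    ∎)
  where open ≡-Reasoning

rotate-injective : ∀ {m i j} (b : Fin m) → i < m → j < m → rotate i b ≡ rotate j b → i ≡ j
rotate-injective {i = i} {j} b i<m j<m eq with <-cmp i j
... | tri< i<j _ _ = contradiction eq (rotate-≢ b i<j j<m)
... | tri≈ _ i≡j _ = i≡j
... | tri> _ _ j<i = contradiction (sym eq) (rotate-≢ b j<i i<m)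

orbit : ∀ {m} → Fin m → List (Fin m)
orbit {m} b = applyUpTo (λ k → rotate k b) m

orbit-unique : ∀ {m} (b : Fin m) → Unique (orbit b)
orbit-unique {m} b = Unique.applyUpTo⁺₁ _ m (rotate-≢ b)

length-orbit : ∀ {m} (b : Fin m) → length (orbit b) ≡ m
length-orbit {m} b = length-applyUpTo _ m

next prev : ∀ {m} → Fin m → Fin m
next = rotate 1
prev {suc m} = rotate m

Succ-next : ∀ {m} (b : Fin m) → Succ m b (next b)
Succ-next {m} b = subst (λ a → Succ m a (next b)) (rotate-zero b) (Succ-rotate 0 b)

Succ-prev : ∀ {m} (b : Fin m) → Succ m (prev b) b
Succ-prev {suc m} b = subst (Succ (suc m) (prev b)) (rotate-period b) (Succ-rotate m b)

next≢prev : ∀ {m} → 3 ≤ m → (b : Fin m) → next b ≢ prev b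
next≢prev 3≤m b eq = Succℕ-asym 3≤m (Succ-next b) (subst (λ c → Succ _ c b) (sym eq) (Succ-prev b))

TorusAdj'? : ∀ {n m} (v w : Fin n × Fin m) → Dec (TorusAdj' n m v w)
TorusAdj'? (a , b) (c , d) = ((a ≟ᶠ c) ×-dec CycleAdj? b d) ⊎-dec ((b ≟ᶠ d) ×-dec CycleAdj? a c)

TorusAdj'-swap : ∀ {n m} {x y : Fin m × Fin n} → TorusAdj' m n x y → TorusAdj' n m (swap x) (swap y)
TorusAdj'-swap = Sum.swap

TorusAdj'-irrefl : ∀ {n m} {x : Fin n × Fin m} → 2 ≤ n → 2 ≤ m → ¬ TorusAdj' n m x x
TorusAdj'-irrefl _   2≤m (inj₁ (_ , adj)) = CycleAdj-irrefl 2≤m adj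
TorusAdj'-irrefl 2≤n _   (inj₂ (_ , adj)) = CycleAdj-irrefl 2≤n adj

common-neighbour : ∀ {n m} {a a′ : Fin n} {b b′ : Fin m} {z} → a ≢ a′ → b ≢ b′ →
                   TorusAdj' n m (a , b′) z → TorusAdj' n m (a′ , b) z → z ≡ (a , b) ⊎ z ≡ (a′ , b′)
common-neighbour a≢a′ _    (inj₁ (refl , _))   (inj₁ (a′≡a , _)) = contradiction (sym a′≡a) a≢a′
common-neighbour _    _    (inj₁ (refl , _))   (inj₂ (refl , _)) = inj₁ refl
common-neighbour _    _    (inj₂ (refl , _))   (inj₁ (refl , _)) = inj₂ refl
common-neighbour _    b≢b′ (inj₂ (b′≡b , _)) (inj₂ (refl , _)) = contradiction (sym b′≡b) b≢b′

Good : ∀ {n m} → ℕ → (Fin n × Fin m → Set) → Fin n × Fin m → Set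
Good {n} {m} g Q v =
  Σ[ ys ∈ List (Fin n × Fin m) ] Unique ys × g ≤ length ys × All (λ y → TorusAdj' n m v y × Q y) ys

Good-transpose : ∀ {n m g} {Q : Fin n × Fin m → Set} {v} → Good g Q v → Good g (Q ∘ swap) (swap v)
Good-transpose {g = g} (ys , ys-unique , g≤ys , ys-good) =
  map swap ys , Unique.map⁺ (cong swap) ys-unique , subst (g ≤_) (sym (length-map swap ys)) g≤ys ,
  All.map⁺ (All.map (λ (adj , q) → TorusAdj'-swap adj , q) ys-good)

-- Counting

AtMost : ∀ {A : Set} → ℕ → (A → Set) → Set
AtMost k P = ∀ {xs} → Unique xs → All P xs → length xs ≤ k

AtMost-comap : ∀ {A B : Set} {k} {P : B → Set} (f : A → B) → (∀ {x y} → f x ≡ f y → x ≡ y) →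
               AtMost k P → AtMost k (λ x → P (f x))
AtMost-comap f f-inj bound {xs} u ps =
  subst (_≤ _) (length-map f xs) (bound (Unique.map⁺ f-inj u) (All.map⁺ ps))

length-filter-∁ : ∀ {A : Set} {P : A → Set} (P? : Decidable P) xs →
                  length xs ≡ length (filter P? xs) + length (filter (λ x → ¬? (P? x)) xs)
length-filter-∁ P? [] = refl
length-filter-∁ P? (x ∷ xs) with does (P? x)
... | true  = cong suc (length-filter-∁ P? xs)
... | false = trans (cong suc (length-filter-∁ P? xs)) (sym (+-suc _ _))

AtMost-∣p∣ : ∀ {N} (p : Subset N) → AtMost ∣ p ∣ (_∈ p)
AtMost-∣p∣ p {[]} _ _ = z≤n
AtMost-∣p∣ p {x ∷ xs} (x∉xs ∷ u) (x∈p ∷ xs∈p) =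
  <-≤-trans (s≤s (AtMost-∣p∣ (p - x) u (All.zipWith in-p-x (xs∈p , x∉xs)))) (x∈p⇒∣p-x∣<∣p∣ x∈p)
  where
    in-p-x : ∀ {y} → y ∈ p × x ≢ y → y ∈ p - x
    in-p-x (y∈p , x≢y) = x∈p∧x∉q⇒x∈p─q y∈p (x≢y⇒x∉⁅y⁆ (x≢y ∘ sym))

∣p∪q∣≤∣p∣+∣q∣ : ∀ {N} (p q : Subset N) → ∣ p ∪ q ∣ ≤ ∣ p ∣ + ∣ q ∣
∣p∪q∣≤∣p∣+∣q∣ []            []            = z≤n
∣p∪q∣≤∣p∣+∣q∣ (inside ∷ p)  (s ∷ q)       =
  s≤s (≤-trans (∣p∪q∣≤∣p∣+∣q∣ p q) (+-monoʳ-≤ ∣ p ∣ (∣p∣≤∣x∷p∣ s q)))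
∣p∪q∣≤∣p∣+∣q∣ (outside ∷ p) (inside ∷ q)  =
  ≤-trans (s≤s (∣p∪q∣≤∣p∣+∣q∣ p q)) (≤-reflexive (sym (+-suc ∣ p ∣ ∣ q ∣)))
∣p∪q∣≤∣p∣+∣q∣ (outside ∷ p) (outside ∷ q) = ∣p∪q∣≤∣p∣+∣q∣ p q

fromList : ∀ {N} → List (Fin N) → Subset N
fromList = foldr (λ x p → ⁅ x ⁆ ∪ p) ∅

∣fromList∣≤length : ∀ {N} (xs : List (Fin N)) → ∣ fromList xs ∣ ≤ length xs
∣fromList∣≤length {N} []  = ≤-reflexive (∣⊥∣≡0 N)
∣fromList∣≤length (x ∷ xs) = ≤-trans (∣p∪q∣≤∣p∣+∣q∣ ⁅ x ⁆ (fromList xs))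
                                     (+-mono-≤ (≤-reflexive (∣⁅x⁆∣≡1 x)) (∣fromList∣≤length xs))

∈-fromList⁺ : ∀ {N} {x : Fin N} {xs} → x ∈ₗ xs → x ∈ fromList xs
∈-fromList⁺ {x = x} (here refl) = x∈p∪q⁺ (inj₁ (x∈⁅x⁆ x))
∈-fromList⁺ (there x∈xs)        = x∈p∪q⁺ (inj₂ (∈-fromList⁺ x∈xs))

∈-fromList⁻ : ∀ {N} {x : Fin N} xs → x ∈ fromList xs → x ∈ₗ xs
∈-fromList⁻ []       x∈∅ = contradiction x∈∅ ∉⊥
∈-fromList⁻ (y ∷ ys) x∈ with x∈p∪q⁻ ⁅ y ⁆ (fromList ys) x∈
... | inj₁ x∈⁅y⁆ = here (x∈⁅y⁆⇒x≡y y x∈⁅y⁆)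
... | inj₂ x∈ys  = there (∈-fromList⁻ ys x∈ys)

∣p∣≤length : ∀ {N} {p : Subset N} xs → (∀ {x} → x ∈ p → x ∈ₗ xs) → ∣ p ∣ ≤ length xs
∣p∣≤length xs p⊆xs = ≤-trans (p⊆q⇒∣p∣≤∣q∣ (∈-fromList⁺ ∘ p⊆xs)) (∣fromList∣≤length xs)

members : ∀ {N} → Subset N → List (Fin N)
members {N} p = filter (_∈? p) (allFin N)

members-unique : ∀ {N} (p : Subset N) → Unique (members p)
members-unique {N} p = Unique.filter⁺ (_∈? p) (Unique.allFin⁺ N)

members-∈ : ∀ {N} (p : Subset N) → All (_∈ p) (members p)
members-∈ {N} p = All.all-filter (_∈? p) (allFin N)

∣p∣≤length-members : ∀ {N} (p : Subset N) → ∣ p ∣ ≤ length (members p)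
∣p∣≤length-members p = ∣p∣≤length (members p) λ {x} x∈p → ∈-filter⁺ (_∈? p) (∈-allFin x) x∈p

-- The PMC model on an arbitrary graph

module _ {N : ℕ} {Adj : Fin N → Fin N → Set} where

  Distinguishable-sym : ∀ {F₁ F₂} → Distinguishable Adj F₁ F₂ → Distinguishable Adj F₂ F₁
  Distinguishable-sym (u , v , u∈F₁△F₂ , v∉F₁ , v∉F₂ , adj) =
    u , v , Sum.swap u∈F₁△F₂ , v∉F₂ , v∉F₁ , adj

  distinguishable? : (∀ u v → Dec (Adj u v)) → ∀ F₁ F₂ → Dec (Distinguishable Adj F₁ F₂)
  distinguishable? adj? F₁ F₂ = any? λ u → any? λ v →
    (((u ∈? F₁) ×-dec ¬? (u ∈? F₂)) ⊎-dec ((u ∈? F₂) ×-dec ¬? (u ∈? F₁))) ×-dec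
    ¬? (v ∈? F₁) ×-dec ¬? (v ∈? F₂) ×-dec adj? u v

  diagnosable-by-inclusion : ∀ {g t} → (∀ u v → Dec (Adj u v)) →
    (∀ {F₁ F₂} → GoodNeighbor Adj g F₂ → ∣ F₁ ∣ ≤ t → ∣ F₂ ∣ ≤ t →
                 ¬ Distinguishable Adj F₁ F₂ → F₁ ⊆ F₂) →
    Diagnosable Adj g t
  diagnosable-by-inclusion adj? included F₁ F₂ good₁ good₂ ∣F₁∣≤t ∣F₂∣≤t F₁≢F₂ =
    decidable-stable (distinguishable? adj? F₁ F₂) λ indistinguishable →
      F₁≢F₂ (⊆-antisym (included good₂ ∣F₁∣≤t ∣F₂∣≤t indistinguishable)
                       (included good₁ ∣F₂∣≤t ∣F₁∣≤t (indistinguishable ∘ Distinguishable-sym)))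

  diagnosability-< : ∀ {g t F₁ F₂} → Diagnosable Adj g t → GoodNeighbor Adj g F₁ → GoodNeighbor Adj g F₂ →
                     F₁ ⊆ F₂ → F₁ ≢ F₂ → (∀ {u v} → u ∈ F₂ → u ∉ F₁ → Adj u v → v ∈ F₂) →
                     t < ∣ F₂ ∣
  diagnosability-< {t = t} {F₁} {F₂} diagnosable good₁ good₂ F₁⊆F₂ F₁≢F₂ closed with ∣ F₂ ∣ ≤? t
  ... | no ∣F₂∣≰t = ≰⇒> ∣F₂∣≰t
  ... | yes ∣F₂∣≤t
    with diagnosable F₁ F₂ good₁ good₂ (≤-trans (p⊆q⇒∣p∣≤∣q∣ F₁⊆F₂) ∣F₂∣≤t) ∣F₂∣≤t F₁≢F₂
  ...   | u , v , inj₁ (u∈F₁ , u∉F₂) , _ , _    , _   = contradiction (F₁⊆F₂ u∈F₁) u∉F₂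
  ...   | u , v , inj₂ (u∈F₂ , u∉F₁) , _ , v∉F₂ , adj = contradiction (closed u∈F₂ u∉F₁ adj) v∉F₂

-- Agreed and disputed vertices on rows and columns

-- Agreed and Disputed stand for F₁ ∩ F₂ and F₁ △ F₂, where F₁ and F₂ are indistinguishable, so that
-- every neighbour of a disputed vertex is faulty.
module Runs {n m : ℕ} (Agreed Disputed : Fin n × Fin m → Set)
  (spread : ∀ {x y} → TorusAdj' n m x y → Disputed x → Agreed y ⊎ Disputed y) where

  Faulty : Fin n × Fin m → Set
  Faulty v = Agreed v ⊎ Disputed v

  RowPair : Fin n → Set
  RowPair a = Σ[ c₁ ∈ Fin m ] Σ[ c₂ ∈ Fin m ] c₁ ≢ c₂ × Agreed (a , c₁) × Agreed (a , c₂)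

  FullRow : Fin n → Fin m → Set
  FullRow a b = ∀ {k} → k < m → Faulty (a , rotate k b)

  FirstAgreed : (ℕ → Fin n × Fin m) → ℕ → Set
  FirstAgreed p K = Σ[ i ∈ ℕ ] 0 < i × i ≤ K × Agreed (p i) × (∀ {k} → k < i → Disputed (p k))

  run : ∀ (p : ℕ → Fin n × Fin m) K → (∀ {k} → k < K → TorusAdj' n m (p k) (p (suc k))) →
        Disputed (p 0) → (∀ {k} → k ≤ K → Disputed (p k)) ⊎ FirstAgreed p K
  run p zero    adj d₀ = inj₁ λ { z≤n → d₀ }
  run p (suc K) adj d₀ with run p K (adj ∘ m≤n⇒m≤1+n) d₀
  ... | inj₂ (i , 0<i , i≤K , agreed , before) = inj₂ (i , 0<i , m≤n⇒m≤1+n i≤K , agreed , before)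
  ... | inj₁ upto-K with spread (adj ≤-refl) (upto-K ≤-refl)
  ...   | inj₁ agreed   = inj₂ (suc K , z<s , ≤-refl , agreed , upto-K ∘ ≤-pred)
  ...   | inj₂ disputed = inj₁ upto-1+K
    where
      upto-1+K : ∀ {k} → k ≤ suc K → Disputed (p k)
      upto-1+K k≤1+K with m≤n⇒m<n∨m≡n k≤1+K
      ... | inj₁ k<1+K = upto-K (≤-pred k<1+K)
      ... | inj₂ refl  = disputed

  module _ {a : Fin n} {b : Fin m} where

    private
      K : ℕ
      K = pred m

      ≤K⇒<m : ∀ {k} → k ≤ K → k < m
      ≤K⇒<m k≤K = <-≤-trans (s≤s k≤K) (≤-reflexive (suc-pred m ⦃ >-nonZero (<-≤-trans z<s (toℕ<n b)) ⦄))

      m∸k≤K : ∀ {k} → 0 < k → k ≤ m → m ∸ k ≤ K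
      m∸k≤K 0<k k≤m = <⇒≤pred (∸-monoʳ-< 0<k k≤m)

      forward backward : ℕ → Fin n × Fin m
      forward k = a , rotate k b
      backward k = a , rotate (m ∸ k) b

      backward-flip : ∀ {k} → k < m → backward (m ∸ k) ≡ forward k
      backward-flip k<m = cong (λ i → a , rotate i b) (m∸[m∸n]≡n (<⇒≤ k<m))

      forward-adj : ∀ {k} → k < K → TorusAdj' n m (forward k) (forward (suc k))
      forward-adj {k} _ = inj₁ (refl , inj₁ (Succ-rotate k b))

      backward-adj : ∀ {k} → k < K → TorusAdj' n m (backward k) (backward (suc k))
      backward-adj {k} k<K = inj₁ (refl , inj₂ (subst (λ i → Succ m (rotate (m ∸ suc k) b) (rotate i b))
                                                      (sym (+-∸-assoc 1 (<⇒≤ (≤K⇒<m k<K))))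
                                                      (Succ-rotate (m ∸ suc k) b)))

    -- Walk from b in both directions.  Each walk stops at its first agreed vertex, and if the two stop
    -- at the same vertex, the walks together have visited the whole row.
    row-pair-or-full : Disputed (a , b) → RowPair a ⊎ FullRow a b
    row-pair-or-full d
      with run forward K forward-adj (subst Disputed (sym (cong (a ,_) (rotate-zero b))) d)
    ... | inj₁ all-disputed = inj₂ λ k<m → inj₂ (all-disputed (<⇒≤pred k<m))
    ... | inj₂ (i , 0<i , i≤K , agreedᵢ , beforeᵢ)
      with run backward K backward-adj (subst Disputed (sym (cong (a ,_) (rotate-period b))) d)
    ...   | inj₁ all-disputed = inj₂ full
      where
        full : FullRow a b
        full {k} k<m with k <? i
        ... | yes k<i = inj₂ (beforeᵢ k<i)
        ... | no k≮i  = inj₂ (subst Disputed (backward-flip k<m)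
                                    (all-disputed (m∸k≤K (<-≤-trans 0<i (≮⇒≥ k≮i)) (<⇒≤ k<m))))
    ...   | inj₂ (j , 0<j , j≤K , agreedⱼ , beforeⱼ) with i ≟ m ∸ j
    ...     | no i≢m∸j =
      inj₁ (rotate i b , rotate (m ∸ j) b ,
            i≢m∸j ∘ rotate-injective b (≤K⇒<m i≤K) (≤K⇒<m (m∸k≤K 0<j (<⇒≤ (≤K⇒<m j≤K)))) ,
            agreedᵢ , agreedⱼ)
    ...     | yes refl = inj₂ full
      where
        full : FullRow a b
        full {k} k<m with <-cmp k i
        ... | tri< k<i _ _  = inj₂ (beforeᵢ k<i)
        ... | tri≈ _ refl _ = inj₁ agreedᵢ
        ... | tri> _ _ i<k  = inj₂ (subst Disputed (backward-flip k<m) (beforeⱼ m∸k<j))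
          where
            m∸k<j : m ∸ k < j
            m∸k<j = subst (m ∸ k <_) (m∸[m∸n]≡n (<⇒≤ (≤K⇒<m j≤K))) (∸-monoʳ-< i<k (<⇒≤ k<m))

module Crossing {n m : ℕ} (8≤n : 8 ≤ n) (8≤m : 8 ≤ m)
  (Agreed Disputed : Fin n × Fin m → Set) (agreed? : Decidable Agreed)
  (spread : ∀ {x y} → TorusAdj' n m x y → Disputed x → Agreed y ⊎ Disputed y)
  (agreed≤7 : AtMost 7 Agreed) (faulty≤22 : AtMost 22 (λ v → Agreed v ⊎ Disputed v)) where

  open Runs Agreed Disputed spread public

  private
    module Column = Runs (Agreed ∘ swap) (Disputed ∘ swap) (spread ∘ TorusAdj'-swap)

  -- Each disputed column contributes two agreed cells or a whole faulty column of n ≥ 8 cells, so with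
  -- agreed cells counted four times every column weighs at least 8.
  record ColumnCells (cs : List (Fin m)) : Set where
    field
      agreed-cells faulty-cells : List (Fin n × Fin m)
      agreed-unique : Unique agreed-cells
      faulty-unique : Unique faulty-cells
      agreed-in : All (λ v → Agreed v × proj₂ v ∈ₗ cs) agreed-cells
      faulty-in : All (λ v → Faulty v × proj₂ v ∈ₗ cs) faulty-cells
      weight : length cs * 8 ≤ length agreed-cells * 4 + length faulty-cells

  private
    fresh : ∀ {P : Fin n × Fin m → Set} {c cs vs} r → c ∉ₗ cs →
            All (λ v → P v × proj₂ v ∈ₗ cs) vs → All ((r , c) ≢_) vs
    fresh r c∉cs = All.map λ (_ , c′∈cs) eq → c∉cs (subst (_∈ₗ _) (sym (cong proj₂ eq)) c′∈cs)

    widen : ∀ {P : Fin n × Fin m → Set} {c cs vs} → All (λ v → P v × proj₂ v ∈ₗ cs) vs →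
            All (λ v → P v × proj₂ v ∈ₗ c ∷ cs) vs
    widen = All.map λ (p , c′∈cs) → p , there c′∈cs

  private
    add-pair : ∀ {c cs} → c ∉ₗ cs → ColumnCells cs → Column.RowPair c → ColumnCells (c ∷ cs)
    add-pair {c} c∉cs w (r₁ , r₂ , r₁≢r₂ , agreed₁ , agreed₂) = record
      { agreed-cells = (r₁ , c) ∷ (r₂ , c) ∷ agreed-cells
      ; faulty-cells = faulty-cells
      ; agreed-unique = ((r₁≢r₂ ∘ cong proj₁) ∷ fresh r₁ c∉cs agreed-in) ∷ fresh r₂ c∉cs agreed-in ∷ agreed-unique
      ; faulty-unique = faulty-unique
      ; agreed-in = (agreed₁ , here refl) ∷ (agreed₂ , here refl) ∷ widen agreed-in
      ; faulty-in = widen faulty-in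
      ; weight = +-monoʳ-≤ 8 weight }
      where open ColumnCells w

    add-column : ∀ {a c cs} → c ∉ₗ cs → ColumnCells cs → Column.FullRow c a → ColumnCells (c ∷ cs)
    add-column {a} {c} c∉cs w full = record
      { agreed-cells = agreed-cells
      ; faulty-cells = column ++ faulty-cells
      ; agreed-unique = agreed-unique
      ; faulty-unique = Unique.++⁺ (Unique.map⁺ (cong proj₁) (orbit-unique a)) faulty-unique disjoint
      ; agreed-in = widen agreed-in
      ; faulty-in = All.++⁺ (All.map⁺ (All.applyUpTo⁺₁ _ n λ k<n → full k<n , here refl)) (widen faulty-in)
      ; weight = ≤-trans (+-mono-≤ 8≤n weight) (≤-reflexive (begin
          n + (length agreed-cells * 4 + length faulty-cells)
            ≡⟨ x∙yz≈y∙xz n (length agreed-cells * 4) (length faulty-cells) ⟩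
          length agreed-cells * 4 + (n + length faulty-cells)
            ≡⟨ cong (λ k → length agreed-cells * 4 + (k + length faulty-cells)) length-column ⟨
          length agreed-cells * 4 + (length column + length faulty-cells)
            ≡⟨ cong (length agreed-cells * 4 +_) (length-++ column) ⟨
          length agreed-cells * 4 + length (column ++ faulty-cells) ∎)) }
      where
        open ColumnCells w
        open ≡-Reasoning
        column : List (Fin n × Fin m)
        column = map (_, c) (orbit a)
        length-column : length column ≡ n
        length-column = trans (length-map (_, c) (orbit a)) (length-orbit a)
        disjoint : ∀ {v} → ¬ (v ∈ₗ column × v ∈ₗ faulty-cells)
        disjoint (v∈column , v∈faulty) with ∈-map⁻ (_, c) v∈column
        ... | _ , _ , refl = c∉cs (proj₂ (All.lookup faulty-in v∈faulty))

  column-cells : ∀ {a cs} → Unique cs → All (λ c → Disputed (a , c)) cs → ColumnCells cs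
  column-cells [] [] = record
    { agreed-cells = [] ; faulty-cells = [] ; agreed-unique = [] ; faulty-unique = []
    ; agreed-in = [] ; faulty-in = [] ; weight = z≤n }
  column-cells (c∉cs ∷ u) (d ∷ ds) with Column.row-pair-or-full d
  ... | inj₁ pair = add-pair (All.All¬⇒¬Any c∉cs) (column-cells u ds) pair
  ... | inj₂ full = add-column (All.All¬⇒¬Any c∉cs) (column-cells u ds) full

  no-column-cells : ∀ {cs} → 7 ≤ length cs → ¬ ColumnCells cs
  no-column-cells {cs} 7≤cs w = 1+n≰n (begin
    51                                             ≤⟨ m≤m+n 51 5 ⟩
    7 * 8                                          ≤⟨ *-monoˡ-≤ 8 7≤cs ⟩
    length cs * 8                                  ≤⟨ weight ⟩
    length agreed-cells * 4 + length faulty-cells  ≤⟨ +-mono-≤ (*-monoˡ-≤ 4 agreed≤) faulty≤ ⟩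
    7 * 4 + 22                                     ∎)
    where
      open ColumnCells w
      open ≤-Reasoning
      agreed≤ = agreed≤7 agreed-unique (All.map proj₁ agreed-in)
      faulty≤ = faulty≤22 faulty-unique (All.map proj₁ faulty-in)

  private
    agreed-at? : ∀ a → Decidable (λ c → Agreed (a , c))
    agreed-at? a c = agreed? (a , c)

    disputed-at : Fin n → List (Fin m) → List (Fin m)
    disputed-at a = filter (¬? ∘ agreed-at? a)

    disputed-at-disputed : ∀ {a} cs → All (λ c → Faulty (a , c)) cs →
                           All (λ c → Disputed (a , c)) (disputed-at a cs)
    disputed-at-disputed {a} cs faulty =
      All.zipWith disputed (All.filter⁺ (¬? ∘ agreed-at? a) faulty , All.all-filter (¬? ∘ agreed-at? a) cs)
      where
        disputed : ∀ {v} → Faulty v × ¬ Agreed v → Disputed v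
        disputed (inj₁ agreed   , ¬agreed) = contradiction agreed ¬agreed
        disputed (inj₂ disputed , _)       = disputed

  pair-or-disputed : ∀ {a} cs → Unique cs → All (λ c → Faulty (a , c)) cs →
                     RowPair a ⊎ Σ[ ds ∈ List (Fin m) ] Unique ds × All (λ c → Disputed (a , c)) ds ×
                                                         length cs ≤ suc (length ds)
  pair-or-disputed {a} cs u faulty
    with filter (agreed-at? a) cs | Unique.filter⁺ (agreed-at? a) u | All.all-filter (agreed-at? a) cs
       | length-filter-∁ (agreed-at? a) cs
  ... | c₁ ∷ c₂ ∷ _ | (c₁≢c₂ ∷ _) ∷ _ | agreed₁ ∷ agreed₂ ∷ _ | _ =
    inj₁ (c₁ , c₂ , c₁≢c₂ , agreed₁ , agreed₂)
  ... | []     | _ | _ | split =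
    inj₂ (disputed-at a cs , Unique.filter⁺ _ u , disputed-at-disputed cs faulty ,
          ≤-trans (≤-reflexive split) (n≤1+n _))
  ... | _ ∷ [] | _ | _ | split =
    inj₂ (disputed-at a cs , Unique.filter⁺ _ u , disputed-at-disputed cs faulty , ≤-reflexive split)

  row-pair : ∀ {a b} → Disputed (a , b) → RowPair a
  row-pair {a} {b} d with row-pair-or-full d
  ... | inj₁ pair = pair
  ... | inj₂ full with pair-or-disputed (orbit b) (orbit-unique b) (All.applyUpTo⁺₁ _ m full)
  ...   | inj₁ pair = pair
  ...   | inj₂ (ds , u , disputed , m≤1+ds) =
    contradiction (column-cells u disputed)
                  (no-column-cells (≤-pred (≤-trans 8≤m (subst (_≤ _) (length-orbit b) m≤1+ds))))

-- Pairs of indistinguishable faulty sets on the torus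

∨⇒∧⊎xor : ∀ a b → T (a ∨ b) → T (a ∧ b) ⊎ T (a xor b)
∨⇒∧⊎xor true  true  _ = inj₁ _
∨⇒∧⊎xor true  false _ = inj₂ _
∨⇒∧⊎xor false true  _ = inj₂ _

∧⊎xor⇒∨ : ∀ a b → T (a ∧ b) ⊎ T (a xor b) → T (a ∨ b)
∧⊎xor⇒∨ true  _     _ = _
∧⊎xor⇒∨ false true  _ = _
∧⊎xor⇒∨ false false (inj₁ ())
∧⊎xor⇒∨ false false (inj₂ ())

∧⇒¬xor : ∀ a b → T (a ∧ b) → ¬ T (a xor b)
∧⇒¬xor true true _ ()

∧-not⇒xor : ∀ a b → T (a ∧ not b) → T (a xor b)
∧-not⇒xor true false _ = _

∧-not⇒¬T : ∀ a b → T (a ∧ not b) → ¬ T b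
∧-not⇒¬T true true ()

∧⇒Tˡ : ∀ a b → T (a ∧ b) → T a
∧⇒Tˡ true _ _ = _

T×¬T⇒∧-not : ∀ a b → T a → ¬ T b → T (a ∧ not b)
T×¬T⇒∧-not true true  _ ¬b = ¬b _
T×¬T⇒∧-not true false _ _  = _

∨-resolveˡ : ∀ a b → T (a ∨ b) → ¬ T a → T b
∨-resolveˡ true  _ _ ¬a = contradiction _ ¬a
∨-resolveˡ false _ b _  = b

∨-resolveʳ : ∀ a b → T (a ∨ b) → ¬ T b → T a
∨-resolveʳ _     true  _ ¬b = contradiction _ ¬b
∨-resolveʳ true  false _ _  = _

xor-split : ∀ a b → T (a xor b) → (T a × ¬ T b) ⊎ (T b × ¬ T a)
xor-split true  false _ = inj₁ (_ , λ ())
xor-split false true  _ = inj₂ (_ , λ ())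

record IndistinguishablePair (n m t : ℕ) : Set where
  field
    in₁ in₂ : Fin n × Fin m → Bool
    size₁ : AtMost t (T ∘ in₁)
    size₂ : AtMost t (T ∘ in₂)
    closed : ∀ {x y} → TorusAdj' n m x y → T (in₁ x xor in₂ x) → T (in₁ y ∨ in₂ y)

  Agreed Disputed OnlyFirst : Fin n × Fin m → Set
  Agreed v = T (in₁ v ∧ in₂ v)
  Disputed v = T (in₁ v xor in₂ v)
  OnlyFirst v = T (in₁ v ∧ not (in₂ v))

  agreed? : Decidable Agreed
  agreed? v = T? (in₁ v ∧ in₂ v)

  spread : ∀ {x y} → TorusAdj' n m x y → Disputed x → Agreed y ⊎ Disputed y
  spread {y = y} adj d = ∨⇒∧⊎xor (in₁ y) (in₂ y) (closed adj d)

  faulty-bound : AtMost (t + t) (λ v → Agreed v ⊎ Disputed v)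
  faulty-bound {xs} u faulty = begin
    length xs                                                 ≡⟨ length-filter-∁ (T? ∘ in₁) xs ⟩
    length (filter first? xs) + length (filter second? xs)  ≤⟨ +-mono-≤ first second ⟩
    t + t                                                     ∎
    where
      open ≤-Reasoning
      first? : Decidable (T ∘ in₁)
      first? = T? ∘ in₁
      second? : Decidable (¬_ ∘ T ∘ in₁)
      second? = ¬? ∘ T? ∘ in₁
      only-second : ∀ {v} → (Agreed v ⊎ Disputed v) × ¬ T (in₁ v) → T (in₂ v)
      only-second {v} (faulty , ¬first) = ∨-resolveˡ (in₁ v) (in₂ v) (∧⊎xor⇒∨ (in₁ v) (in₂ v) faulty) ¬first
      first = size₁ (Unique.filter⁺ first? u) (All.all-filter first? xs)
      second = size₂ (Unique.filter⁺ second? u)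
                     (All.zipWith only-second (All.filter⁺ second? faulty , All.all-filter second? xs))

  first-bound : ∀ {core cs} → Unique core → All OnlyFirst core → Unique cs → All Agreed cs →
                length core + length cs ≤ t
  first-bound {core} {cs} core-unique core-first cs-unique cs-agreed =
    subst (_≤ t) (length-++ core)
      (size₁ (Unique.++⁺ core-unique cs-unique disjoint)
             (All.++⁺ (All.map (λ {v} → ∧⇒Tˡ (in₁ v) _) core-first) (All.map (λ {v} → ∧⇒Tˡ (in₁ v) _) cs-agreed)))
    where
      disjoint : ∀ {v} → ¬ (v ∈ₗ core × v ∈ₗ cs)
      disjoint {v} (v∈core , v∈cs) = ∧⇒¬xor (in₁ v) (in₂ v) (All.lookup cs-agreed v∈cs)
                                            (∧-not⇒xor (in₁ v) (in₂ v) (All.lookup core-first v∈core))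

  agreed-bound : ∀ {k core} → Unique core → All OnlyFirst core → t ≤ k + length core → AtMost k Agreed
  agreed-bound {k} {core} core-unique core-first t≤k+core {cs} cs-unique cs-agreed =
    +-cancelˡ-≤ (length core) (length cs) k (begin
      length core + length cs  ≤⟨ first-bound core-unique core-first cs-unique cs-agreed ⟩
      t                        ≤⟨ t≤k+core ⟩
      k + length core          ≡⟨ +-comm k (length core) ⟩
      length core + k          ∎)
    where open ≤-Reasoning

  FirstDegree : ℕ → Set
  FirstDegree g = ∀ {v} → OnlyFirst v → Good g OnlyFirst v

transpose : ∀ {n m t} → IndistinguishablePair n m t → IndistinguishablePair m n t
transpose P = record
  { in₁ = in₁ ∘ swap
  ; in₂ = in₂ ∘ swap
  ; size₁ = AtMost-comap swap (cong swap) size₁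
  ; size₂ = AtMost-comap swap (cong swap) size₂
  ; closed = closed ∘ TorusAdj'-swap }
  where open IndistinguishablePair P

transpose-degree : ∀ {n m t g} (P : IndistinguishablePair n m t) →
                   IndistinguishablePair.FirstDegree P g → IndistinguishablePair.FirstDegree (transpose P) g
transpose-degree P degree first = Good-transpose (degree first)

module Crosses {n m t : ℕ} (8≤n : 8 ≤ n) (8≤m : 8 ≤ m) (P : IndistinguishablePair n m t) (t≤11 : t ≤ 11)
  (agreed≤7 : AtMost 7 (IndistinguishablePair.Agreed P)) where

  open IndistinguishablePair P

  private
    faulty≤22 : AtMost 22 (λ v → Agreed v ⊎ Disputed v)
    faulty≤22 u faulty = ≤-trans (faulty-bound u faulty) (+-mono-≤ t≤11 t≤11)

    module Rows = Crossing 8≤n 8≤m Agreed Disputed agreed? spread agreed≤7 faulty≤22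
    module Columns = Crossing 8≤m 8≤n (Agreed ∘ swap) (Disputed ∘ swap) (agreed? ∘ swap) (spread ∘ TorusAdj'-swap)
                              (AtMost-comap swap (cong swap) agreed≤7) (AtMost-comap swap (cong swap) faulty≤22)

  open Rows public using (RowPair; row-pair)

  ColumnPair : Fin m → Set
  ColumnPair = Columns.RowPair

  column-pair : ∀ {a b} → Disputed (a , b) → ColumnPair b
  column-pair = Columns.row-pair

  record CrossCells (a : Fin n) (cs : List (Fin m)) : Set where
    field
      cells : List (Fin n × Fin m)
      cells-unique : Unique cells
      cells-agreed : All Agreed cells
      cells-lines : All (λ v → proj₁ v ≡ a ⊎ proj₂ v ∈ₗ cs) cells
      length-cells : length cells ≡ 2 + length cs * 2

  cross-cells : ∀ {a} cs → Unique cs → All (λ c → Disputed (a , c)) cs → RowPair a → CrossCells a cs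
  cross-cells {a} [] [] [] (c₁ , c₂ , c₁≢c₂ , agreed₁ , agreed₂) = record
    { cells = (a , c₁) ∷ (a , c₂) ∷ []
    ; cells-unique = ((c₁≢c₂ ∘ cong proj₂) ∷ []) ∷ [] ∷ []
    ; cells-agreed = agreed₁ ∷ agreed₂ ∷ []
    ; cells-lines = inj₁ refl ∷ inj₁ refl ∷ []
    ; length-cells = refl }
  cross-cells {a} (c ∷ cs) (c∉cs ∷ u) (d ∷ ds) pair with column-pair d
  ... | r₁ , r₂ , r₁≢r₂ , agreed₁ , agreed₂ = record
    { cells = (r₁ , c) ∷ (r₂ , c) ∷ cells
    ; cells-unique = ((r₁≢r₂ ∘ cong proj₁) ∷ fresh agreed₁) ∷ fresh agreed₂ ∷ cells-unique
    ; cells-agreed = agreed₁ ∷ agreed₂ ∷ cells-agreed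
    ; cells-lines = inj₂ (here refl) ∷ inj₂ (here refl) ∷ All.map (Sum.map₂ there) cells-lines
    ; length-cells = cong (2 +_) length-cells }
    where
      open CrossCells (cross-cells cs u ds pair)
      fresh : ∀ {r} → Agreed (r , c) → All ((r , c) ≢_) cells
      fresh {r} agreed = All.map apart cells-lines
        where
          apart : ∀ {v} → proj₁ v ≡ a ⊎ proj₂ v ∈ₗ cs → (r , c) ≢ v
          apart (inj₁ refl) refl = ∧⇒¬xor (in₁ (r , c)) (in₂ (r , c)) agreed d
          apart (inj₂ c∈cs) refl = All.All¬⇒¬Any c∉cs c∈cs

  cross-cells-extend : ∀ {a a′ cs} (X : CrossCells a cs) → a′ ≢ a → ∀ {es} → Unique es →
                       All (λ v → proj₁ v ≡ a′ × proj₂ v ∉ₗ cs) es → Unique (es ++ CrossCells.cells X)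
  cross-cells-extend X a′≢a es-unique es-away = Unique.++⁺ es-unique cells-unique disjoint
    where
      open CrossCells X
      disjoint : ∀ {v} → ¬ (v ∈ₗ _ × v ∈ₗ cells)
      disjoint (v∈es , v∈cells) with All.lookup es-away v∈es | All.lookup cells-lines v∈cells
      ... | row≡a′ , _    | inj₁ row≡a     = a′≢a (trans (sym row≡a′) row≡a)
      ... | _ , column∉cs | inj₂ column∈cs = column∉cs column∈cs

  row-pair-avoiding : ∀ {a} → RowPair a → ∀ c → Σ[ e ∈ Fin m ] Agreed (a , e) × e ≢ c
  row-pair-avoiding (e₁ , e₂ , e₁≢e₂ , agreed₁ , agreed₂) c with e₁ ≟ᶠ c
  ... | yes refl = e₂ , agreed₂ , e₁≢e₂ ∘ sym
  ... | no e₁≢c  = e₁ , agreed₁ , e₁≢c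

module Configurations {n m t : ℕ} (8≤n : 8 ≤ n) (8≤m : 8 ≤ m) (P : IndistinguishablePair n m t) where

  open IndistinguishablePair P

  private
    V = Fin n × Fin m
    2≤n = ≤-trans (m≤m+n 2 6) 8≤n
    2≤m = ≤-trans (m≤m+n 2 6) 8≤m
    4≤m = ≤-trans (m≤m+n 4 4) 8≤m

    first⇒disputed : ∀ {v} → OnlyFirst v → Disputed v
    first⇒disputed {v} = ∧-not⇒xor (in₁ v) (in₂ v)

    agreed≢disputed : ∀ {a e c} → Agreed (a , e) → Disputed (a , c) → e ≢ c
    agreed≢disputed {a} {e} agreed disputed refl = ∧⇒¬xor (in₁ (a , e)) (in₂ (a , e)) agreed disputed

    not-diagonal : ∀ {a a′ b b′} → a ≢ a′ → b ≢ b′ → ¬ TorusAdj' n m (a , b′) (a′ , b)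
    not-diagonal a≢a′ _    (inj₁ (a≡a′ , _)) = a≢a′ a≡a′
    not-diagonal _    b≢b′ (inj₂ (b′≡b , _)) = b≢b′ (sym b′≡b)

    _≟ᵛ_ : DecidableEquality V
    _≟ᵛ_ = ≡-dec _≟ᶠ_ _≟ᶠ_

    too-many : ∀ {core cs k} → Unique core → All OnlyFirst core → Unique cs → All Agreed cs →
               length cs ≡ k → t < length core + k → ⊥
    too-many core-unique core-first cs-unique cs-agreed refl t<core+cs =
      <⇒≱ t<core+cs (first-bound core-unique core-first cs-unique cs-agreed)

  record OtherNeighbour (w avoid : V) : Set where
    field
      vertex : V
      adjacent : TorusAdj' n m w vertex
      first : OnlyFirst vertex
      vertex≢avoid : vertex ≢ avoid

  other-neighbour : FirstDegree 2 → ∀ {w} → OnlyFirst w → ∀ avoid → OtherNeighbour w avoid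
  other-neighbour degree first avoid with degree first
  ... | [] , _ , () , _
  ... | _ ∷ [] , _ , s≤s () , _
  ... | y₁ ∷ y₂ ∷ _ , (y₁≢y₂ ∷ _) ∷ _ , _ , (adj₁ , first₁) ∷ (adj₂ , first₂) ∷ _ with y₁ ≟ᵛ avoid
  ...   | yes refl    = record { vertex = y₂ ; adjacent = adj₂ ; first = first₂ ; vertex≢avoid = y₁≢y₂ ∘ sym }
  ...   | no y₁≢avoid = record { vertex = y₁ ; adjacent = adj₁ ; first = first₁ ; vertex≢avoid = y₁≢avoid }

  -- F₁ contains (a , b) and the agreed pairs on row a and column b: 1 + 4 > t.
  single-case : t ≤ 4 → ∀ {a b} → OnlyFirst (a , b) → ⊥
  single-case t≤4 {a} {b} first =
    too-many core-unique (first ∷ []) cells-unique cells-agreed length-cells (s≤s t≤4)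
    where
      d = first⇒disputed first
      core-unique : Unique ((a , b) ∷ [])
      core-unique = [] ∷ []
      open Crosses 8≤n 8≤m P (≤-trans t≤4 (m≤m+n 4 7))
                   (agreed-bound core-unique (first ∷ []) (≤-trans t≤4 (m≤m+n 4 4)))
      open CrossCells (cross-cells (b ∷ []) ([] ∷ []) (d ∷ []) (row-pair d))

  -- F₁ contains both ends and the agreed pairs on row a and columns b, b′: 2 + 6 > t.
  edge-case : t ≤ 7 → ∀ {a b b′} → OnlyFirst (a , b) → OnlyFirst (a , b′) → CycleAdj m b b′ → ⊥
  edge-case t≤7 {a} {b} {b′} first first′ adj =
    too-many core-unique (first ∷ first′ ∷ []) cells-unique cells-agreed length-cells (s≤s t≤7)
    where
      b≢b′ = CycleAdj⇒≢ 2≤m adj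
      core-unique : Unique ((a , b) ∷ (a , b′) ∷ [])
      core-unique = ((b≢b′ ∘ cong proj₂) ∷ []) ∷ [] ∷ []
      open Crosses 8≤n 8≤m P (≤-trans t≤7 (m≤m+n 7 4))
                   (agreed-bound core-unique (first ∷ first′ ∷ []) (≤-trans t≤7 (m≤m+n 7 2)))
      open CrossCells (cross-cells (b ∷ b′ ∷ []) ((b≢b′ ∷ []) ∷ [] ∷ [])
                                   (first⇒disputed first ∷ first⇒disputed first′ ∷ [])
                                   (row-pair (first⇒disputed first)))

  -- F₁ contains the three vertices, a further neighbour z of (a , b₂), and the agreed pairs on row a
  -- and the three columns: 4 + 8 > t.
  straight-case : t ≤ 11 → FirstDegree 2 → ∀ {a b b₁ b₂} →
                  OnlyFirst (a , b) → OnlyFirst (a , b₁) → OnlyFirst (a , b₂) →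
                  CycleAdj m b b₁ → CycleAdj m b b₂ → b₁ ≢ b₂ → ⊥
  straight-case t≤11 degree {a} {b} {b₁} {b₂} first first₁ first₂ adj₁ adj₂ b₁≢b₂ =
    too-many core-unique (first ∷ first₁ ∷ first₂ ∷ Z.first ∷ []) cells-unique cells-agreed length-cells (s≤s t≤11)
    where
      module Z = OtherNeighbour (other-neighbour degree first₂ (a , b))
      b≢b₁ = CycleAdj⇒≢ 2≤m adj₁
      b≢b₂ = CycleAdj⇒≢ 2≤m adj₂
      z≢y₁ : Z.vertex ≢ (a , b₁)
      z≢y₁ z≡y₁ with subst (TorusAdj' n m (a , b₂)) z≡y₁ Z.adjacent
      ... | inj₁ (_ , adj₂₁)  = CycleAdj-triangle-free 4≤m adj₁ adj₂ b₁≢b₂ (CycleAdj-sym adj₂₁)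
      ... | inj₂ (b₂≡b₁ , _) = b₁≢b₂ (sym b₂≡b₁)
      z≢y₂ : Z.vertex ≢ (a , b₂)
      z≢y₂ z≡y₂ = TorusAdj'-irrefl 2≤n 2≤m (subst (TorusAdj' n m (a , b₂)) z≡y₂ Z.adjacent)
      core-unique : Unique ((a , b) ∷ (a , b₁) ∷ (a , b₂) ∷ Z.vertex ∷ [])
      core-unique = ((b≢b₁ ∘ cong proj₂) ∷ (b≢b₂ ∘ cong proj₂) ∷ (Z.vertex≢avoid ∘ sym) ∷ [])
                  ∷ ((b₁≢b₂ ∘ cong proj₂) ∷ (z≢y₁ ∘ sym) ∷ [])
                  ∷ ((z≢y₂ ∘ sym) ∷ []) ∷ [] ∷ []
      open Crosses 8≤n 8≤m P t≤11 (agreed-bound core-unique (first ∷ first₁ ∷ first₂ ∷ Z.first ∷ []) t≤11)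
      open CrossCells (cross-cells (b ∷ b₁ ∷ b₂ ∷ []) ((b≢b₁ ∷ b≢b₂ ∷ []) ∷ (b₁≢b₂ ∷ []) ∷ [] ∷ [])
                                   (first⇒disputed first ∷ first⇒disputed first₁ ∷ first⇒disputed first₂ ∷ [])
                                   (row-pair (first⇒disputed first)))

  -- F₁ contains the four corners, the agreed pairs on row a and columns b, b′, and the agreed pair on
  -- row a′, which avoids the disputed columns b and b′: 4 + 8 > t.
  square-case : t ≤ 11 → ∀ {a a′ b b′} → OnlyFirst (a , b) → OnlyFirst (a , b′) → OnlyFirst (a′ , b) →
                OnlyFirst (a′ , b′) → a ≢ a′ → b ≢ b′ → ⊥
  square-case t≤11 {a} {a′} {b} {b′} first first-b′ first-a′ first-a′b′ a≢a′ b≢b′ =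
    finish (row-pair (first⇒disputed first-a′))
    where
      core-first = first ∷ first-b′ ∷ first-a′ ∷ first-a′b′ ∷ []
      core-unique : Unique ((a , b) ∷ (a , b′) ∷ (a′ , b) ∷ (a′ , b′) ∷ [])
      core-unique = ((b≢b′ ∘ cong proj₂) ∷ (a≢a′ ∘ cong proj₁) ∷ (a≢a′ ∘ cong proj₁) ∷ [])
                  ∷ ((a≢a′ ∘ cong proj₁) ∷ (a≢a′ ∘ cong proj₁) ∷ [])
                  ∷ ((b≢b′ ∘ cong proj₂) ∷ []) ∷ [] ∷ []
      open Crosses 8≤n 8≤m P t≤11 (agreed-bound core-unique core-first t≤11)
      X = cross-cells (b ∷ b′ ∷ []) ((b≢b′ ∷ []) ∷ [] ∷ [])
                      (first⇒disputed first ∷ first⇒disputed first-b′ ∷ []) (row-pair (first⇒disputed first))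
      open CrossCells X
      finish : RowPair a′ → ⊥
      finish (e₁ , e₂ , e₁≢e₂ , agreed₁ , agreed₂) =
        too-many core-unique core-first
          (cross-cells-extend X (a≢a′ ∘ sym) (((e₁≢e₂ ∘ cong proj₂) ∷ []) ∷ [] ∷ [])
                              (away agreed₁ ∷ away agreed₂ ∷ []))
          (agreed₁ ∷ agreed₂ ∷ cells-agreed) (cong (2 +_) length-cells) (s≤s t≤11)
        where
          away : ∀ {e} → Agreed (a′ , e) → a′ ≡ a′ × e ∉ₗ b ∷ b′ ∷ []
          away agreed = refl , All.All¬⇒¬Any (agreed≢disputed agreed (first⇒disputed first-a′)
                                              ∷ agreed≢disputed agreed (first⇒disputed first-a′b′) ∷ [])

  open-corner-unique : ∀ {a a′ b b′} (Z : OtherNeighbour (a , b′) (a , b))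
                       (Z′ : OtherNeighbour (a′ , b) (a , b)) → ¬ OnlyFirst (a′ , b′) → a ≢ a′ → b ≢ b′ →
                       Unique ((a , b) ∷ (a , b′) ∷ (a′ , b) ∷ OtherNeighbour.vertex Z ∷ OtherNeighbour.vertex Z′ ∷ [])
  open-corner-unique {a} {a′} {b} {b′} Z Z′ ¬first-a′b′ a≢a′ b≢b′ =
      ((b≢b′ ∘ cong proj₂) ∷ (a≢a′ ∘ cong proj₁) ∷ (Z.vertex≢avoid ∘ sym) ∷ (Z′.vertex≢avoid ∘ sym) ∷ [])
    ∷ ((a≢a′ ∘ cong proj₁) ∷ y₁≢z ∷ y₁≢z′ ∷ [])
    ∷ (y₂≢z ∷ y₂≢z′ ∷ [])
    ∷ (z≢z′ ∷ []) ∷ [] ∷ []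
    where
      module Z  = OtherNeighbour Z
      module Z′ = OtherNeighbour Z′
      z≢z′ : Z.vertex ≢ Z′.vertex
      z≢z′ z≡z′
        with common-neighbour a≢a′ b≢b′ Z.adjacent (subst (TorusAdj' n m (a′ , b)) (sym z≡z′) Z′.adjacent)
      ... | inj₁ z≡ab   = Z.vertex≢avoid z≡ab
      ... | inj₂ z≡a′b′ = ¬first-a′b′ (subst OnlyFirst z≡a′b′ Z.first)
      y₁≢z : (a , b′) ≢ Z.vertex
      y₁≢z y₁≡z = TorusAdj'-irrefl 2≤n 2≤m (subst (TorusAdj' n m (a , b′)) (sym y₁≡z) Z.adjacent)
      y₁≢z′ : (a , b′) ≢ Z′.vertex
      y₁≢z′ y₁≡z′ =
        not-diagonal (a≢a′ ∘ sym) (b≢b′ ∘ sym) (subst (TorusAdj' n m (a′ , b)) (sym y₁≡z′) Z′.adjacent)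
      y₂≢z : (a′ , b) ≢ Z.vertex
      y₂≢z y₂≡z = not-diagonal a≢a′ b≢b′ (subst (TorusAdj' n m (a , b′)) (sym y₂≡z) Z.adjacent)
      y₂≢z′ : (a′ , b) ≢ Z′.vertex
      y₂≢z′ y₂≡z′ = TorusAdj'-irrefl 2≤n 2≤m (subst (TorusAdj' n m (a′ , b)) (sym y₂≡z′) Z′.adjacent)

  -- F₁ contains the three corners, further neighbours z of (a , b′) and z′ of (a′ , b), which differ
  -- because the fourth corner is not in F₁ ∖ F₂, the agreed pairs on row a and columns b, b′, and an
  -- agreed vertex of row a′ outside these columns: 5 + 7 > t.
  open-corner-case : t ≤ 11 → FirstDegree 2 → ∀ {a a′ b b′} → OnlyFirst (a , b) → OnlyFirst (a , b′) →
                     OnlyFirst (a′ , b) → ¬ OnlyFirst (a′ , b′) → a ≢ a′ → b ≢ b′ → ⊥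
  open-corner-case t≤11 degree {a} {a′} {b} {b′} first first-b′ first-a′ ¬first-a′b′ a≢a′ b≢b′ =
    too-many core-unique core-first
      (cross-cells-extend X (a≢a′ ∘ sym) ([] ∷ []) ((refl , All.All¬⇒¬Any (e≢b ∷ e≢b′ ∷ [])) ∷ []))
      (e-agreed ∷ cells-agreed) (cong suc length-cells) (s≤s t≤11)
    where
      Z  = other-neighbour degree first-b′ (a , b)
      Z′ = other-neighbour degree first-a′ (a , b)
      core-first = first ∷ first-b′ ∷ first-a′ ∷ OtherNeighbour.first Z ∷ OtherNeighbour.first Z′ ∷ []
      core-unique = open-corner-unique Z Z′ ¬first-a′b′ a≢a′ b≢b′
      open Crosses 8≤n 8≤m P t≤11 (agreed-bound core-unique core-first (≤-trans t≤11 (m≤m+n 11 1)))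
      X = cross-cells (b ∷ b′ ∷ []) ((b≢b′ ∷ []) ∷ [] ∷ [])
                      (first⇒disputed first ∷ first⇒disputed first-b′ ∷ []) (row-pair (first⇒disputed first))
      open CrossCells X
      avoiding = row-pair-avoiding (row-pair (first⇒disputed first-a′)) b′
      e-agreed = proj₁ (proj₂ avoiding)
      e≢b′ = proj₂ (proj₂ avoiding)
      e≢b = agreed≢disputed e-agreed (first⇒disputed first-a′)

  corner-case : t ≤ 11 → FirstDegree 2 → ∀ {a a′ b b′} →
                OnlyFirst (a , b) → OnlyFirst (a , b′) → OnlyFirst (a′ , b) → CycleAdj n a a′ → CycleAdj m b b′ → ⊥
  corner-case t≤11 degree {a} {a′} {b} {b′} first first-b′ first-a′ adj-a adj-b
    with T? (in₁ (a′ , b′) ∧ not (in₂ (a′ , b′)))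
  ... | yes first-a′b′ =
    square-case t≤11 first first-b′ first-a′ first-a′b′ (CycleAdj⇒≢ 2≤n adj-a) (CycleAdj⇒≢ 2≤m adj-b)
  ... | no ¬first-a′b′ =
    open-corner-case t≤11 degree first first-b′ first-a′ ¬first-a′b′ (CycleAdj⇒≢ 2≤n adj-a) (CycleAdj⇒≢ 2≤m adj-b)

no-only-first₀ : ∀ {n m t} → 8 ≤ n → 8 ≤ m → (P : IndistinguishablePair n m t) → t ≤ 4 →
                 ∀ {u} → ¬ IndistinguishablePair.OnlyFirst P u
no-only-first₀ 8≤n 8≤m P t≤4 = Configurations.single-case 8≤n 8≤m P t≤4

no-only-first₁ : ∀ {n m t} → 8 ≤ n → 8 ≤ m → (P : IndistinguishablePair n m t) → t ≤ 7 →
                 IndistinguishablePair.FirstDegree P 1 → ∀ {u} → ¬ IndistinguishablePair.OnlyFirst P u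
no-only-first₁ 8≤n 8≤m P t≤7 degree first with degree first
... | [] , _ , () , _
... | _ ∷ _ , _ , _ , (inj₁ (refl , adj) , first′) ∷ _ =
  Configurations.edge-case 8≤n 8≤m P t≤7 first first′ adj
... | _ ∷ _ , _ , _ , (inj₂ (refl , adj) , first′) ∷ _ =
  Configurations.edge-case 8≤m 8≤n (transpose P) t≤7 first first′ adj

no-only-first₂ : ∀ {n m t} → 8 ≤ n → 8 ≤ m → (P : IndistinguishablePair n m t) → t ≤ 11 →
                 IndistinguishablePair.FirstDegree P 2 → ∀ {u} → ¬ IndistinguishablePair.OnlyFirst P u
no-only-first₂ 8≤n 8≤m P t≤11 degree first with degree first
... | [] , _ , () , _
... | _ ∷ [] , _ , s≤s () , _
... | _ ∷ _ ∷ _ , (y₁≢y₂ ∷ _) ∷ _ , _ , (adj₁ , first₁) ∷ (adj₂ , first₂) ∷ _ with adj₁ | adj₂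
...   | inj₁ (refl , c₁) | inj₁ (refl , c₂) =
  Configurations.straight-case 8≤n 8≤m P t≤11 degree first first₁ first₂ c₁ c₂ (y₁≢y₂ ∘ cong (_ ,_))
...   | inj₂ (refl , c₁) | inj₂ (refl , c₂) =
  Configurations.straight-case 8≤m 8≤n (transpose P) t≤11 (transpose-degree P degree) first first₁ first₂ c₁ c₂
                               (y₁≢y₂ ∘ cong (_, _))
...   | inj₁ (refl , c₁) | inj₂ (refl , c₂) =
  Configurations.corner-case 8≤n 8≤m P t≤11 degree first first₁ first₂ c₂ c₁
...   | inj₂ (refl , c₁) | inj₁ (refl , c₂) =
  Configurations.corner-case 8≤n 8≤m P t≤11 degree first first₂ first₁ c₁ c₂

∈⇒T-lookup : ∀ {N} {p : Subset N} {x} → x ∈ p → T (lookup p x)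
∈⇒T-lookup x∈p = Equivalence.from T-≡ ([]=⇒lookup x∈p)

T-lookup⇒∈ : ∀ {N} {p : Subset N} {x} → T (lookup p x) → x ∈ p
T-lookup⇒∈ {p = p} {x} t = lookup⇒[]= x p (Equivalence.to T-≡ t)

module _ {n m : ℕ} where

  cell : Fin (n * m) → Fin n × Fin m
  cell = remQuot m

  index : Fin n × Fin m → Fin (n * m)
  index (a , b) = combine a b

  cell-index : ∀ v → cell (index v) ≡ v
  cell-index (a , b) = remQuot-combine a b

  index-cell : ∀ x → index (cell x) ≡ x
  index-cell = combine-remQuot {n} m

  cell-injective : ∀ {x y} → cell x ≡ cell y → x ≡ y
  cell-injective {x} {y} eq = trans (sym (index-cell x)) (trans (cong index eq) (index-cell y))

  index-injective : ∀ {v w} → index v ≡ index w → v ≡ w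
  index-injective {v} {w} eq = trans (sym (cell-index v)) (trans (cong cell eq) (cell-index w))

  TorusAdj? : ∀ x y → Dec (TorusAdj n m x y)
  TorusAdj? x y = TorusAdj'? (cell x) (cell y)

  TorusAdj-index : ∀ {v w} → TorusAdj' n m v w → TorusAdj n m (index v) (index w)
  TorusAdj-index {v} {w} = subst₂ (TorusAdj' n m) (sym (cell-index v)) (sym (cell-index w))

  module _ {t} (F₁ F₂ : Subset (n * m)) (∣F₁∣≤t : ∣ F₁ ∣ ≤ t) (∣F₂∣≤t : ∣ F₂ ∣ ≤ t)
           (indistinguishable : ¬ Distinguishable (TorusAdj n m) F₁ F₂) where

    private
      in₁ in₂ : Fin n × Fin m → Bool
      in₁ v = lookup F₁ (index v)
      in₂ v = lookup F₂ (index v)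

      size : ∀ F → ∣ F ∣ ≤ t → AtMost t (λ v → T (lookup F (index v)))
      size F ∣F∣≤t =
        AtMost-comap index index-injective λ u ts → ≤-trans (AtMost-∣p∣ F u (All.map T-lookup⇒∈ ts)) ∣F∣≤t

      membership : ∀ {v} → (T (in₁ v) × ¬ T (in₂ v)) ⊎ (T (in₂ v) × ¬ T (in₁ v)) →
                   (index v ∈ F₁ × index v ∉ F₂) ⊎ (index v ∈ F₂ × index v ∉ F₁)
      membership (inj₁ (t₁ , ¬t₂)) = inj₁ (T-lookup⇒∈ t₁ , ¬t₂ ∘ ∈⇒T-lookup)
      membership (inj₂ (t₂ , ¬t₁)) = inj₂ (T-lookup⇒∈ t₂ , ¬t₁ ∘ ∈⇒T-lookup)

      closed : ∀ {x y} → TorusAdj' n m x y → T (in₁ x xor in₂ x) → T (in₁ y ∨ in₂ y)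
      closed {x} {y} adj disputed = decidable-stable (T? _) λ ¬faulty →
        indistinguishable (index x , index y , membership (xor-split _ _ disputed) ,
                           ¬faulty ∘ Equivalence.from T-∨ ∘ inj₁ ∘ ∈⇒T-lookup ,
                           ¬faulty ∘ Equivalence.from T-∨ ∘ inj₂ ∘ ∈⇒T-lookup ,
                           TorusAdj-index adj)

    indistinguishable-pair : IndistinguishablePair n m t
    indistinguishable-pair = record
      { in₁ = in₁
      ; in₂ = in₂
      ; size₁ = size F₁ ∣F₁∣≤t
      ; size₂ = size F₂ ∣F₂∣≤t
      ; closed = closed }

    open IndistinguishablePair indistinguishable-pair using (OnlyFirst; FirstDegree)

    first-degree : ∀ {g} → GoodNeighbor (TorusAdj n m) g F₂ → FirstDegree g
    first-degree {g} good {v} first with good (index v) (∧-not⇒¬T (in₁ v) (in₂ v) first ∘ ∈⇒T-lookup)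
    ... | S , g≤∣S∣ , S-good =
      map cell (members S) , Unique.map⁺ cell-injective (members-unique S) ,
      ≤-trans g≤∣S∣ (≤-trans (∣p∣≤length-members S) (≤-reflexive (sym (length-map cell (members S))))) ,
      All.map⁺ (All.map neighbour (members-∈ S))
      where
        neighbour : ∀ {u} → u ∈ S → TorusAdj' n m v (cell u) × OnlyFirst (cell u)
        neighbour {u} u∈S with S-good u u∈S
        ... | adj , u∉F₂ = adj′ , T×¬T⇒∧-not _ _ (∨-resolveʳ _ _ faulty ¬second) ¬second
          where
            adj′ : TorusAdj' n m v (cell u)
            adj′ = subst (λ w → TorusAdj' n m w (cell u)) (cell-index v) adj
            faulty : T (in₁ (cell u) ∨ in₂ (cell u))
            faulty = closed adj′ (∧-not⇒xor (in₁ v) (in₂ v) first)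
            ¬second : ¬ T (in₂ (cell u))
            ¬second = u∉F₂ ∘ subst (_∈ F₂) (index-cell u) ∘ T-lookup⇒∈

torus-diagnosable : ∀ {n m g t} →
  (∀ (P : IndistinguishablePair n m t) → IndistinguishablePair.FirstDegree P g →
   ∀ {u} → ¬ IndistinguishablePair.OnlyFirst P u) →
  Diagnosable (TorusAdj n m) g t
torus-diagnosable {n} {m} no-first = diagnosable-by-inclusion TorusAdj? included
  where
    included : ∀ {F₁ F₂} → GoodNeighbor (TorusAdj n m) _ F₂ → ∣ F₁ ∣ ≤ _ → ∣ F₂ ∣ ≤ _ →
               ¬ Distinguishable (TorusAdj n m) F₁ F₂ → F₁ ⊆ F₂
    included {F₁} {F₂} good ∣F₁∣≤t ∣F₂∣≤t indistinguishable {x} x∈F₁ with x ∈? F₂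
    ... | yes x∈F₂ = x∈F₂
    ... | no x∉F₂ =
      contradiction first (no-first P (first-degree F₁ F₂ ∣F₁∣≤t ∣F₂∣≤t indistinguishable good))
      where
        P = indistinguishable-pair F₁ F₂ ∣F₁∣≤t ∣F₂∣≤t indistinguishable
        first : IndistinguishablePair.OnlyFirst P (cell x)
        first rewrite index-cell {n} {m} x = T×¬T⇒∧-not _ _ (∈⇒T-lookup x∈F₁) (x∉F₂ ∘ T-lookup⇒∈)

-- Upper bounds

module _ {n m : ℕ} where

  ⟦_⟧ : ∀ {P : Fin n × Fin m → Set} → Decidable P → Subset (n * m)
  ⟦ P? ⟧ = tabulate (λ x → isYes (P? (cell x)))

  module _ {P : Fin n × Fin m → Set} (P? : Decidable P) where

    ∈⟦⟧⁻ : ∀ {x} → x ∈ ⟦ P? ⟧ → P (cell x)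
    ∈⟦⟧⁻ {x} x∈ = toWitness {a? = P? (cell x)} (subst T (lookup∘tabulate _ x) (∈⇒T-lookup x∈))

    ∈⟦⟧⁺ : ∀ {x} → P (cell x) → x ∈ ⟦ P? ⟧
    ∈⟦⟧⁺ {x} p = T-lookup⇒∈ (subst T (sym (lookup∘tabulate _ x)) (fromWitness {a? = P? (cell x)} p))

    index∈⟦⟧ : ∀ {v} → P v → index v ∈ ⟦ P? ⟧
    index∈⟦⟧ {v} p = ∈⟦⟧⁺ (subst P (sym (cell-index v)) p)

    index∈⟦⟧⁻ : ∀ {v} → index v ∈ ⟦ P? ⟧ → P v
    index∈⟦⟧⁻ {v} = subst P (cell-index v) ∘ ∈⟦⟧⁻

    good-complement : ∀ {g} → (∀ v → ¬ P v → Good g (¬_ ∘ P) v) → GoodNeighbor (TorusAdj n m) g ⟦ P? ⟧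
    good-complement {g} good x x∉ with good (cell x) (x∉ ∘ ∈⟦⟧⁺)
    ... | ys , ys-unique , g≤ys , ys-good =
      fromList (map index ys) ,
      ≤-trans g≤ys (≤-trans (≤-reflexive (sym (length-map index ys)))
                            (AtMost-∣p∣ _ (Unique.map⁺ index-injective ys-unique) (All.tabulate ∈-fromList⁺))) ,
      λ u u∈ → neighbour (∈-map⁻ index (∈-fromList⁻ (map index ys) u∈))
      where
        neighbour : ∀ {u} → ∃ (λ y → y ∈ₗ ys × u ≡ index y) → TorusAdj n m x u × u ∉ ⟦ P? ⟧
        neighbour (y , y∈ys , refl) with All.lookup ys-good y∈ys
        ... | adj , ¬Py = subst (TorusAdj' n m (cell x)) (sym (cell-index y)) adj , ¬Py ∘ index∈⟦⟧⁻

    ∣⟦⟧∣≤ : ∀ cover → (∀ {v} → P v → v ∈ₗ cover) → ∣ ⟦ P? ⟧ ∣ ≤ length cover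
    ∣⟦⟧∣≤ cover covers = begin
      ∣ ⟦ P? ⟧ ∣               ≤⟨ ∣p∣≤length (map index cover) index-covers ⟩
      length (map index cover)  ≡⟨ length-map index cover ⟩
      length cover              ∎
      where
        open ≤-Reasoning
        index-covers : ∀ {x} → x ∈ ⟦ P? ⟧ → x ∈ₗ map index cover
        index-covers {x} x∈ = subst (_∈ₗ map index cover) (index-cell {n} {m} x) (∈-map⁺ index (covers (∈⟦⟧⁻ x∈)))

-- F₁ = Boundary and F₂ = Inner ∪ Boundary are g-good faulty sets that no test tells apart, and
-- F₂ has at most s vertices.
record Shape (n m g s : ℕ) : Set₁ where
  field
    Inner Boundary : Fin n × Fin m → Set
    inner? : Decidable Inner
    boundary? : Decidable Boundary
    inner⇒¬boundary : ∀ {v} → Inner v → ¬ Boundary v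
    some-inner : ∃ Inner
    inner-spread : ∀ {x y} → Inner x → TorusAdj' n m x y → Inner y ⊎ Boundary y
    boundary-good : ∀ v → ¬ Boundary v → Good g (¬_ ∘ Boundary) v
    closure-good : ∀ v → ¬ (Inner v ⊎ Boundary v) → Good g (λ y → ¬ (Inner y ⊎ Boundary y)) v
    cover : List (Fin n × Fin m)
    cover-length : length cover ≤ s
    covers : ∀ {v} → Inner v ⊎ Boundary v → v ∈ₗ cover

shape-bound : ∀ {n m g s} → Shape n m g s → ∀ {t} → Diagnosable (TorusAdj n m) g t → t < s
shape-bound {n} {m} shape diagnosable =
  ≤-trans (diagnosability-< diagnosable (good-complement boundary? boundary-good)
                            (good-complement closure? closure-good)
                            (∈⟦⟧⁺ closure? ∘ inj₂ ∘ ∈⟦⟧⁻ boundary?) F₁≢F₂ closed)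
          (≤-trans (∣⟦⟧∣≤ closure? cover covers) cover-length)
  where
    open Shape shape
    closure? : Decidable (λ v → Inner v ⊎ Boundary v)
    closure? v = inner? v ⊎-dec boundary? v
    F₁≢F₂ : ⟦ boundary? ⟧ ≢ ⟦ closure? ⟧
    F₁≢F₂ eq with some-inner
    ... | v , inner =
      inner⇒¬boundary inner (index∈⟦⟧⁻ boundary? (subst (index v ∈_) (sym eq) (index∈⟦⟧ closure? (inj₁ inner))))
    closed : ∀ {u v} → u ∈ ⟦ closure? ⟧ → u ∉ ⟦ boundary? ⟧ → TorusAdj n m u v → v ∈ ⟦ closure? ⟧
    closed {u} u∈ u∉ adj with ∈⟦⟧⁻ closure? u∈
    ... | inj₁ inner = ∈⟦⟧⁺ closure? (inner-spread inner adj)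
    ... | inj₂ boundary = contradiction (∈⟦⟧⁺ boundary? boundary) u∉

Within : ℕ → ℕ → Set
Within k i = 1 ≤ i × i ≤ k

Rim : ℕ → ℕ → Set
Rim k i = i ≡ 0 ⊎ i ≡ suc k

within? : ∀ k i → Dec (Within k i)
within? k i = (1 ≤? i) ×-dec (i ≤? k)

rim? : ∀ k i → Dec (Rim k i)
rim? k i = (i ≟ 0) ⊎-dec (i ≟ suc k)

data Position (k i : ℕ) : Set where
  low : i ≡ 0 → Position k i
  within : Within k i → Position k i
  high : i ≡ suc k → Position k i
  far : suc (suc k) ≤ i → Position k i

position : ∀ k i → Position k i
position k zero = low refl
position k (suc i) with <-cmp i k
... | tri< i<k _ _ = within (s≤s z≤n , i<k)
... | tri≈ _ refl _ = high refl
... | tri> _ _ k<i = far (s≤s k<i)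

rim⇒¬within : ∀ {k i} → Rim k i → ¬ Within k i
rim⇒¬within (inj₁ refl) (() , _)
rim⇒¬within (inj₂ refl) (_ , 1+k≤k) = 1+n≰n 1+k≤k

far⇒¬within : ∀ {k i} → suc (suc k) ≤ i → ¬ Within k i
far⇒¬within 2+k≤i (_ , i≤k) = 1+n≰n (≤-trans (≤-trans (n≤1+n _) 2+k≤i) i≤k)

far⇒¬rim : ∀ {k i} → suc (suc k) ≤ i → ¬ Rim k i
far⇒¬rim 2+k≤i (inj₁ refl) = contradiction 2+k≤i λ ()
far⇒¬rim 2+k≤i (inj₂ refl) = 1+n≰n 2+k≤i

rim-bounded : ∀ {k i} → Rim k i → i ≤ suc k
rim-bounded (inj₁ refl) = z≤n
rim-bounded (inj₂ refl) = ≤-refl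

rim-or-within : ∀ {k i} → i ≤ suc k → Rim k i ⊎ Within k i
rim-or-within {k} {i} i≤1+k with position k i
... | low i≡0 = inj₁ (inj₁ i≡0)
... | within w = inj₂ w
... | high i≡1+k = inj₁ (inj₂ i≡1+k)
... | far 2+k≤i = contradiction (≤-trans 2+k≤i i≤1+k) 1+n≰n

module _ {n m : ℕ} where

  Good-one : ∀ {Q : Fin n × Fin m → Set} {v y} → TorusAdj' n m v y → Q y → Good 1 Q v
  Good-one adj q = _ ∷ [] , [] ∷ [] , ≤-refl , (adj , q) ∷ []

  Good-two : ∀ {Q : Fin n × Fin m → Set} {v y₁ y₂} → y₁ ≢ y₂ →
             TorusAdj' n m v y₁ → TorusAdj' n m v y₂ → Q y₁ → Q y₂ → Good 2 Q v
  Good-two y₁≢y₂ adj₁ adj₂ q₁ q₂ =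
    _ ∷ _ ∷ [] , (y₁≢y₂ ∷ []) ∷ [] ∷ [] , ≤-refl , (adj₁ , q₁) ∷ (adj₂ , q₂) ∷ []

  Good-three : ∀ {Q : Fin n × Fin m → Set} {v y₁ y₂ y₃} → y₁ ≢ y₂ → y₁ ≢ y₃ → y₂ ≢ y₃ →
               TorusAdj' n m v y₁ → TorusAdj' n m v y₂ → TorusAdj' n m v y₃ →
               Q y₁ → Q y₂ → Q y₃ → Good 3 Q v
  Good-three y₁≢y₂ y₁≢y₃ y₂≢y₃ adj₁ adj₂ adj₃ q₁ q₂ q₃ =
    _ ∷ _ ∷ _ ∷ [] , (y₁≢y₂ ∷ y₁≢y₃ ∷ []) ∷ (y₂≢y₃ ∷ []) ∷ [] ∷ [] , ≤-refl ,
    (adj₁ , q₁) ∷ (adj₂ , q₂) ∷ (adj₃ , q₃) ∷ []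

  Good-weaken : ∀ {g g′} {Q Q′ : Fin n × Fin m → Set} {v} → g ≤ g′ → (∀ {y} → Q y → Q′ y) →
                Good g′ Q v → Good g Q′ v
  Good-weaken g≤g′ Q⇒Q′ (ys , ys-unique , g′≤ys , ys-good) =
    ys , ys-unique , ≤-trans g≤g′ g′≤ys , All.map (λ (adj , q) → adj , Q⇒Q′ q) ys-good

step-bound : ∀ {k K} {x y : Fin k} → Within K (toℕ x) → suc K < k → CycleAdj k x y → toℕ y ≤ suc K
step-bound (_ , x≤K) 1+K<k (inj₁ xy) =
  ≤-trans (≤-reflexive (Succℕ-inner xy (≤-<-trans (s≤s x≤K) 1+K<k))) (s≤s x≤K)
step-bound (_ , x≤K) _ (inj₂ (inj₁ x≡1+y)) =
  ≤-trans (n≤1+n _) (≤-trans (≤-reflexive (sym x≡1+y)) (≤-trans x≤K (n≤1+n _)))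
step-bound (1≤x , _) _ (inj₂ (inj₂ (_ , x≡0))) = contradiction (subst (1 ≤_) x≡0 1≤x) λ ()

within-2 : ∀ {i} → Within 2 i → i ≡ 1 ⊎ i ≡ 2
within-2 (s≤s z≤n , s≤s z≤n)       = inj₁ refl
within-2 (s≤s z≤n , s≤s (s≤s z≤n)) = inj₂ refl

partner : ∀ {k} (x : Fin k) → 3 ≤ k → Within 2 (toℕ x) →
          Σ[ x′ ∈ Fin k ] CycleAdj k x x′ × Within 2 (toℕ x′)
partner x 3≤k w with within-2 w
... | inj₁ x≡1 = next x , inj₁ (Succ-next x) , subst (Within 2) (sym next≡2) (s≤s z≤n , ≤-refl)
  where
    next≡2 : toℕ (next x) ≡ 2
    next≡2 = trans (Succℕ-inner (Succ-next x) (subst (λ i → suc i < _) (sym x≡1) 3≤k)) (cong suc x≡1)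
... | inj₂ x≡2 =
  prev x , inj₂ (Succ-prev x) , subst (Within 2) (sym (Succℕ-pred (Succ-prev x) x≡2)) (≤-refl , m≤m+n 1 1)

toℕ-mod : ∀ {k i} .{{_ : NonZero k}} → i < k → toℕ (i mod k) ≡ i
toℕ-mod i<k = trans (toℕ-fromℕ< _) (m<n⇒m%n≡m i<k)

next-beyond : ∀ {k K} (b : Fin k) → K < toℕ b → ¬ Within K (toℕ (next b))
next-beyond b K<b (1≤b′ , b′≤K) with Succ-next b
... | inj₁ b′≡1+b = <-irrefl refl (<-≤-trans K<b (≤-trans (n≤1+n _) (≤-trans (≤-reflexive (sym b′≡1+b)) b′≤K)))
... | inj₂ (_ , b′≡0) = contradiction (subst (1 ≤_) b′≡0 1≤b′) λ ()

module Rectangle {n m : ℕ} (8≤n : 8 ≤ n) (8≤m : 8 ≤ m)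
                 (h w : ℕ) (1≤h : 1 ≤ h) (h≤2 : h ≤ 2) (1≤w : 1 ≤ w) (w≤2 : w ≤ 2) where

  InnerAt BoundaryAt ClosedAt : ℕ → ℕ → Set
  InnerAt i j = Within h i × Within w j
  BoundaryAt i j = (Rim h i × Within w j) ⊎ (Within h i × Rim w j)
  ClosedAt i j = InnerAt i j ⊎ BoundaryAt i j

  Inner Boundary : Fin n × Fin m → Set
  Inner (a , b) = InnerAt (toℕ a) (toℕ b)
  Boundary (a , b) = BoundaryAt (toℕ a) (toℕ b)

  closedAt? : ∀ i j → Dec (ClosedAt i j)
  closedAt? i j =
    (within? h i ×-dec within? w j) ⊎-dec ((rim? h i ×-dec within? w j) ⊎-dec (within? h i ×-dec rim? w j))

  closed-bounded : ∀ {i j} → ClosedAt i j → i ≤ suc h × j ≤ suc w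
  closed-bounded (inj₁ ((_ , i≤h) , (_ , j≤w)))  = m≤n⇒m≤1+n i≤h , m≤n⇒m≤1+n j≤w
  closed-bounded (inj₂ (inj₁ (rim , (_ , j≤w)))) = rim-bounded rim , m≤n⇒m≤1+n j≤w
  closed-bounded (inj₂ (inj₂ ((_ , i≤h) , rim))) = m≤n⇒m≤1+n i≤h , rim-bounded rim

  far-row : ∀ {i j} → suc (suc h) ≤ i → ¬ ClosedAt i j
  far-row 2+h≤i closed = 1+n≰n (≤-trans 2+h≤i (proj₁ (closed-bounded closed)))

  far-column : ∀ {i j} → suc (suc w) ≤ j → ¬ ClosedAt i j
  far-column 2+w≤j closed = 1+n≰n (≤-trans 2+w≤j (proj₂ (closed-bounded closed)))

  rim-row : ∀ {i j} → Rim h i → ¬ Within w j → ¬ ClosedAt i j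
  rim-row rim _   (inj₁ (within-i , _))         = rim⇒¬within rim within-i
  rim-row _   ¬wj (inj₂ (inj₁ (_ , within-j)))  = ¬wj within-j
  rim-row rim _   (inj₂ (inj₂ (within-i , _)))  = rim⇒¬within rim within-i

  private
    3≤n = ≤-trans (m≤m+n 3 5) 8≤n
    3≤m = ≤-trans (m≤m+n 3 5) 8≤m
    small<n : ∀ {k} → k ≤ 4 → k < n
    small<n k≤4 = ≤-trans (s≤s k≤4) (≤-trans (m≤m+n 5 3) 8≤n)
    small<m : ∀ {k} → k ≤ 4 → k < m
    small<m k≤4 = ≤-trans (s≤s k≤4) (≤-trans (m≤m+n 5 3) 8≤m)
    h+2≤4 : suc (suc h) ≤ 4
    h+2≤4 = s≤s (s≤s h≤2)
    w+2≤4 : suc (suc w) ≤ 4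
    w+2≤4 = s≤s (s≤s w≤2)

  horizontal-away : ∀ (b : Fin m) → ¬ Within w (toℕ b) → Σ[ b′ ∈ Fin m ] CycleAdj m b b′ × ¬ Within w (toℕ b′)
  horizontal-away b ¬wb with position w (toℕ b)
  ... | low b≡0 = prev b , inj₂ (Succ-prev b) , λ (_ , b′≤w) → 1+n≰n (begin
          8                   ≤⟨ 8≤m ⟩
          m                   ≡⟨ Succℕ-wrap (Succ-prev b) b≡0 ⟨
          suc (toℕ (prev b))  ≤⟨ s≤s (≤-trans b′≤w w≤2) ⟩
          3                   ≤⟨ m≤m+n 3 4 ⟩
          7                   ∎)
    where open ≤-Reasoning
  ... | within wb = contradiction wb ¬wb
  ... | high b≡1+w = next b , inj₁ (Succ-next b) , next-beyond b (≤-reflexive (sym b≡1+w))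
  ... | far 2+w≤b = next b , inj₁ (Succ-next b) , next-beyond b (≤-trans (n≤1+n _) 2+w≤b)

  vertical-away : ∀ (a : Fin n) → Rim h (toℕ a) → Σ[ a′ ∈ Fin n ] CycleAdj n a a′ × suc (suc h) ≤ toℕ a′
  vertical-away a (inj₁ a≡0) =
    prev a , inj₂ (Succ-prev a) ,
    ≤-trans h+2≤4 (≤-trans (m≤m+n 4 3) (≤-pred (subst (8 ≤_) (sym (Succℕ-wrap (Succ-prev a) a≡0)) 8≤n)))
  vertical-away a (inj₂ a≡1+h) =
    next a , inj₁ (Succ-next a) , ≤-reflexive (sym (trans (Succℕ-inner (Succ-next a) 1+a<n) (cong suc a≡1+h)))
    where
      1+a<n : suc (toℕ a) < n
      1+a<n = small<n (subst (λ i → suc i ≤ 4) (sym a≡1+h) h+2≤4)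

  Closed : Fin n × Fin m → Set
  Closed v = Inner v ⊎ Boundary v

  rim-good : ∀ {a b} → Rim h (toℕ a) → ¬ Closed (a , b) → Good 2 (¬_ ∘ Closed) (a , b)
  rim-good {a} {b} rim ¬closed with horizontal-away b (¬closed ∘ inj₂ ∘ inj₁ ∘ (rim ,_)) | vertical-away a rim
  ... | b′ , adj-b , ¬wb′ | a′ , adj-a , far-a′ =
    Good-two (λ eq → far⇒¬rim far-a′ (subst (Rim h ∘ toℕ) (cong proj₁ eq) rim))
        (inj₁ (refl , adj-b)) (inj₂ (refl , adj-a)) (rim-row rim ¬wb′) (far-row far-a′)

  closure-good : ∀ v → ¬ Closed v → Good 2 (¬_ ∘ Closed) v
  closure-good (a , b) ¬closed with position h (toℕ a)
  ... | low a≡0 = rim-good (inj₁ a≡0) ¬closed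
  ... | high a≡1+h = rim-good (inj₂ a≡1+h) ¬closed
  ... | far 2+h≤a =
    Good-two (next≢prev 3≤m b ∘ cong proj₂) (inj₁ (refl , inj₁ (Succ-next b))) (inj₁ (refl , inj₂ (Succ-prev b)))
        (far-row 2+h≤a) (far-row 2+h≤a)
  ... | within wa with position w (toℕ b)
  ...   | low b≡0 = contradiction (inj₂ (inj₂ (wa , inj₁ b≡0))) ¬closed
  ...   | within wb = contradiction (inj₁ (wa , wb)) ¬closed
  ...   | high b≡1+w = contradiction (inj₂ (inj₂ (wa , inj₂ b≡1+w))) ¬closed
  ...   | far 2+w≤b =
    Good-two (next≢prev 3≤n a ∘ cong proj₁) (inj₂ (refl , inj₁ (Succ-next a))) (inj₂ (refl , inj₂ (Succ-prev a)))
        (far-column 2+w≤b) (far-column 2+w≤b)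

  inner-spread : ∀ {x y} → Inner x → TorusAdj' n m x y → Closed y
  inner-spread (wa , wb) (inj₁ (refl , adj))
    with rim-or-within (step-bound wb (small<m (≤-trans (n≤1+n _) w+2≤4)) adj)
  ... | inj₁ rim = inj₂ (inj₂ (wa , rim))
  ... | inj₂ wb′ = inj₁ (wa , wb′)
  inner-spread (wa , wb) (inj₂ (refl , adj))
    with rim-or-within (step-bound wa (small<n (≤-trans (n≤1+n _) h+2≤4)) adj)
  ... | inj₁ rim = inj₂ (inj₁ (rim , wb))
  ... | inj₂ wa′ = inj₁ (wa′ , wb)

  inner⇒¬boundary : ∀ {v} → Inner v → ¬ Boundary v
  inner⇒¬boundary (wa , _) (inj₁ (rim , _)) = rim⇒¬within rim wa
  inner⇒¬boundary (_ , wb) (inj₂ (_ , rim)) = rim⇒¬within rim wb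

  instance
    n-nonZero : NonZero n
    n-nonZero = >-nonZero (small<n z≤n)
    m-nonZero : NonZero m
    m-nonZero = >-nonZero (small<m z≤n)

  cellAt : ℕ × ℕ → Fin n × Fin m
  cellAt (i , j) = i mod n , j mod m

  cellAt-coordinates : ∀ (v : Fin n × Fin m) → cellAt (toℕ (proj₁ v) , toℕ (proj₂ v)) ≡ v
  cellAt-coordinates (a , b) = cong₂ _,_ (toℕ-injective (toℕ-mod (toℕ<n a))) (toℕ-injective (toℕ-mod (toℕ<n b)))

  coordinates : List (ℕ × ℕ)
  coordinates = filter (λ (i , j) → closedAt? i j) (cartesianProduct (upTo 4) (upTo 4))

  covers : ∀ {v} → Closed v → v ∈ₗ map cellAt coordinates
  covers {a , b} closed = subst (_∈ₗ map cellAt coordinates) (cellAt-coordinates (a , b))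
    (∈-map⁺ cellAt (∈-filter⁺ (λ (i , j) → closedAt? i j)
      (∈-cartesianProduct⁺ (∈-upTo⁺ (s≤s (≤-trans a≤1+h (≤-pred h+2≤4))))
                           (∈-upTo⁺ (s≤s (≤-trans b≤1+w (≤-pred w+2≤4))))) closed))
    where
      a≤1+h = proj₁ (closed-bounded closed)
      b≤1+w = proj₂ (closed-bounded closed)

  rectangle : ∀ {g} → g ≤ 2 → (∀ {v} → Inner v → Good g Inner v) → Shape n m g (length coordinates)
  rectangle g≤2 inner-good = record
    { Inner = Inner
    ; Boundary = Boundary
    ; inner? = λ (a , b) → within? h (toℕ a) ×-dec within? w (toℕ b)
    ; boundary? = λ (a , b) →
        (rim? h (toℕ a) ×-dec within? w (toℕ b)) ⊎-dec (within? h (toℕ a) ×-dec rim? w (toℕ b))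
    ; inner⇒¬boundary = inner⇒¬boundary
    ; some-inner = cellAt (1 , 1) ,
        subst₂ InnerAt (sym (toℕ-mod (small<n (s≤s z≤n)))) (sym (toℕ-mod (small<m (s≤s z≤n))))
                       ((≤-refl , 1≤h) , (≤-refl , 1≤w))
    ; inner-spread = inner-spread
    ; boundary-good = boundary-good
    ; closure-good = λ v ¬closed → Good-weaken g≤2 (λ ¬c → ¬c) (closure-good v ¬closed)
    ; cover = map cellAt coordinates
    ; cover-length = ≤-reflexive (length-map cellAt coordinates)
    ; covers = covers }
    where
      boundary-good : ∀ v → ¬ Boundary v → Good _ (¬_ ∘ Boundary) v
      boundary-good (a , b) ¬boundary with within? h (toℕ a) ×-dec within? w (toℕ b)
      ... | yes inner = Good-weaken ≤-refl inner⇒¬boundary (inner-good inner)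
      ... | no ¬inner = Good-weaken g≤2 (λ ¬closed → ¬closed ∘ inj₂) (closure-good (a , b) [ ¬inner , ¬boundary ]′)

module Blocks {n m : ℕ} (8≤n : 8 ≤ n) (8≤m : 8 ≤ m) where

  private
    2≤n = ≤-trans (m≤m+n 2 6) 8≤n
    3≤n = ≤-trans (m≤m+n 3 5) 8≤n
    3≤m = ≤-trans (m≤m+n 3 5) 8≤m
    1≤2 = m≤m+n 1 1
    module Point  = Rectangle 8≤n 8≤m 1 1 ≤-refl 1≤2 ≤-refl 1≤2
    module Domino = Rectangle 8≤n 8≤m 1 2 ≤-refl 1≤2 1≤2 ≤-refl
    module Square = Rectangle 8≤n 8≤m 2 2 1≤2 ≤-refl 1≤2 ≤-refl

  point : Shape n m 0 5
  point = Point.rectangle z≤n λ _ → [] , [] , z≤n , []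

  domino : Shape n m 1 8
  domino = Domino.rectangle 1≤2 inner-good
    where
      inner-good : ∀ {v} → Domino.Inner v → Good 1 Domino.Inner v
      inner-good {a , b} (wa , wb) with partner b 3≤m wb
      ... | b′ , adj , wb′ = Good-one (inj₁ (refl , adj)) (wa , wb′)

  square : Shape n m 2 12
  square = Square.rectangle ≤-refl inner-good
    where
      inner-good : ∀ {v} → Square.Inner v → Good 2 Square.Inner v
      inner-good {a , b} (wa , wb) with partner a 3≤n wa | partner b 3≤m wb
      ... | a′ , adj-a , wa′ | b′ , adj-b , wb′ =
        Good-two (CycleAdj⇒≢ 2≤n adj-a ∘ cong proj₁) (inj₁ (refl , adj-b)) (inj₂ (refl , adj-a))
                 (wa , wb′) (wa′ , wb)

length-cartesianProduct : ∀ {A B : Set} (xs : List A) (ys : List B) →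
                          length (cartesianProduct xs ys) ≡ length xs * length ys
length-cartesianProduct [] ys = refl
length-cartesianProduct (x ∷ xs) ys = begin
  length (map (x ,_) ys ++ cartesianProduct xs ys)
    ≡⟨ length-++ (map (x ,_) ys) ⟩
  length (map (x ,_) ys) + length (cartesianProduct xs ys)
    ≡⟨ cong₂ _+_ (length-map (x ,_) ys) (length-cartesianProduct xs ys) ⟩
  length ys + length xs * length ys
    ∎
  where open ≡-Reasoning

module Band {n m : ℕ} (8≤n : 8 ≤ n) (8≤m : 8 ≤ m) where

  Inner Boundary Closed : Fin n × Fin m → Set
  Inner (a , _) = Within 2 (toℕ a)
  Boundary (a , _) = Rim 2 (toℕ a)
  Closed v = Inner v ⊎ Boundary v

  private
    3≤n = ≤-trans (m≤m+n 3 5) 8≤n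
    3≤m = ≤-trans (m≤m+n 3 5) 8≤m
    2≤n = ≤-trans (m≤m+n 2 6) 8≤n
    4<n : 4 < n
    4<n = ≤-trans (m≤m+n 5 3) 8≤n

  far-row : ∀ {i} → 4 ≤ i → ¬ (Within 2 i ⊎ Rim 2 i)
  far-row 4≤i (inj₁ wi) = far⇒¬within 4≤i wi
  far-row 4≤i (inj₂ rim) = far⇒¬rim 4≤i rim

  vertical-far : ∀ (a : Fin n) → 4 ≤ toℕ a → Σ[ a′ ∈ Fin n ] CycleAdj n a a′ × 4 ≤ toℕ a′
  vertical-far a 4≤a with suc (toℕ a) <? n
  ... | yes 1+a<n =
    next a , inj₁ (Succ-next a) ,
    ≤-trans (n≤1+n 4) (≤-trans (s≤s 4≤a) (≤-reflexive (sym (Succℕ-inner (Succ-next a) 1+a<n))))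
  ... | no 1+a≮n with Succ-prev a
  ...   | inj₁ a≡1+a′ = prev a , inj₂ (Succ-prev a) ,
    ≤-trans (m≤m+n 4 2) (≤-pred (≤-pred (≤-trans 8≤n (≤-trans (≮⇒≥ 1+a≮n) (≤-reflexive (cong suc a≡1+a′))))))
  ...   | inj₂ (_ , a≡0) = contradiction (subst (4 ≤_) a≡0 4≤a) λ ()

  closure-good : ∀ v → ¬ Closed v → Good 3 (¬_ ∘ Closed) v
  closure-good (a , b) ¬closed with position 2 (toℕ a)
  ... | low a≡0 = contradiction (inj₂ (inj₁ a≡0)) ¬closed
  ... | within wa = contradiction (inj₁ wa) ¬closed
  ... | high a≡3 = contradiction (inj₂ (inj₂ a≡3)) ¬closed
  ... | far 4≤a with vertical-far a 4≤a
  ...   | a′ , adj , 4≤a′ =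
    Good-three (next≢prev 3≤m b ∘ cong proj₂) row≢ row≢
          (inj₁ (refl , inj₁ (Succ-next b))) (inj₁ (refl , inj₂ (Succ-prev b))) (inj₂ (refl , adj))
          (far-row 4≤a) (far-row 4≤a) (far-row 4≤a′)
    where
      row≢ : ∀ {c} → (a , c) ≢ (a′ , b)
      row≢ = CycleAdj⇒≢ 2≤n adj ∘ cong proj₁

  boundary-good : ∀ v → ¬ Boundary v → Good 3 (¬_ ∘ Boundary) v
  boundary-good (a , b) ¬rim with position 2 (toℕ a)
  ... | low a≡0 = contradiction (inj₁ a≡0) ¬rim
  ... | high a≡3 = contradiction (inj₂ a≡3) ¬rim
  ... | far 4≤a = Good-weaken ≤-refl (λ ¬closed → ¬closed ∘ inj₂) (closure-good (a , b) (far-row 4≤a))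
  ... | within wa with partner a 3≤n wa
  ...   | a′ , adj , wa′ =
    Good-three (next≢prev 3≤m b ∘ cong proj₂) row≢ row≢
          (inj₁ (refl , inj₁ (Succ-next b))) (inj₁ (refl , inj₂ (Succ-prev b))) (inj₂ (refl , adj))
          (λ rim → rim⇒¬within rim wa) (λ rim → rim⇒¬within rim wa) (λ rim → rim⇒¬within rim wa′)
    where
      row≢ : ∀ {c} → (a , c) ≢ (a′ , b)
      row≢ = CycleAdj⇒≢ 2≤n adj ∘ cong proj₁

  band : Shape n m 3 (4 * m)
  band = record
    { Inner = Inner
    ; Boundary = Boundary
    ; inner? = λ (a , _) → within? 2 (toℕ a)
    ; boundary? = λ (a , _) → rim? 2 (toℕ a)
    ; inner⇒¬boundary = λ wa rim → rim⇒¬within rim wa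
    ; some-inner = (1 mod n , 0 mod m) ,
        subst (Within 2) (sym (toℕ-mod (≤-trans (s≤s (s≤s z≤n)) 4<n))) (≤-refl , s≤s z≤n)
    ; inner-spread = inner-spread
    ; boundary-good = boundary-good
    ; closure-good = closure-good
    ; cover = map (λ (i , b) → i mod n , b) rows
    ; cover-length = ≤-reflexive (begin
        length (map _ rows)       ≡⟨ length-map _ rows ⟩
        length rows               ≡⟨ length-cartesianProduct (upTo 4) (allFin m) ⟩
        4 * length (allFin m)     ≡⟨ cong (4 *_) (length-tabulate {n = m} id) ⟩
        4 * m                     ∎)
    ; covers = covers }
    where
      open ≡-Reasoning
      instance
        n-nonZero : NonZero n
        n-nonZero = >-nonZero (≤-trans (s≤s z≤n) 4<n)
        m-nonZero : NonZero m
        m-nonZero = >-nonZero (≤-trans (s≤s z≤n) 8≤m)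
      inner-spread : ∀ {x y} → Inner x → TorusAdj' n m x y → Closed y
      inner-spread wa (inj₁ (refl , _)) = inj₁ wa
      inner-spread wa (inj₂ (refl , adj)) = Sum.swap (rim-or-within (step-bound wa (<-trans (m≤m+n 4 0) 4<n) adj))
      rows : List (ℕ × Fin m)
      rows = cartesianProduct (upTo 4) (allFin m)
      covers : ∀ {v} → Closed v → v ∈ₗ map (λ (i , b) → i mod n , b) rows
      covers {a , b} closed = subst (_∈ₗ _) (cong (_, b) (toℕ-injective (toℕ-mod (toℕ<n a))))
        (∈-map⁺ _ (∈-cartesianProduct⁺ (∈-upTo⁺ (s≤s (row≤3 closed))) (∈-allFin b)))
        where
          row≤3 : Closed (a , b) → toℕ a ≤ 3
          row≤3 (inj₁ (_ , a≤2)) = m≤n⇒m≤1+n a≤2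
          row≤3 (inj₂ rim) = rim-bounded rim

<⇒≤∸1 : ∀ {t k} → t < k → t ≤ k ∸ 1
<⇒≤∸1 {k = suc k} (s≤s t≤k) = t≤k

corollary6p2 : ∀ (n m : ℕ) → 8 ≤ m → m ≤ n →
    (IsDiagnosability (TorusAdj n m) 0 4 ×
     IsDiagnosability (TorusAdj n m) 1 7 ×
     IsDiagnosability (TorusAdj n m) 2 11) ×
    (∀ t → Diagnosable (TorusAdj n m) 3 t → t ≤ 4 * m ∸ 1)
corollary6p2 n m 8≤m m≤n =
  ( (torus-diagnosable (λ P _ → no-only-first₀ 8≤n 8≤m P ≤-refl) , λ _ → ≤-pred ∘ shape-bound point)
  , (torus-diagnosable (λ P → no-only-first₁ 8≤n 8≤m P ≤-refl) , λ _ → ≤-pred ∘ shape-bound domino)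
  , (torus-diagnosable (λ P → no-only-first₂ 8≤n 8≤m P ≤-refl) , λ _ → ≤-pred ∘ shape-bound square) )
  , λ _ → <⇒≤∸1 ∘ shape-bound band
  where
    8≤n = ≤-trans 8≤m m≤n
    open Blocks 8≤n 8≤m
    open Band 8≤n 8≤m using (band)
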